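{- For integers $n, m \geq 0$, let $cp_2(n, m)$ denote the number of partitions of $n$ into $m$ parts $\lambda_1 \leq \cdots \leq \lambda_m$ with no part equal to $2$, such that $\lambda_{i+1} - \lambda_i \geq 2$ for all $i$, and $\lambda_{i+1} - \lambda_i \geq 4$ unless $\lambda_i + \lambda_{i+1}$ is a multiple of $3$. Then \[ \sum_{m, n \geq 0} cp_2(n,m) q^n x^m = \sum_{n_1, n_2 \geq 0} \frac{ q^{6n_2^2 + 3n_2 + 2n_1^2 + n_1 + 6n_2 n_1} (1 + xq^{3n_2 + 2n_1 + 1}) x^{2n_2 + n_1} }{ (q; q)_{n_1} (q^3; q^3)_{n_2} }. \]
   Context: A partition of $n$ into $m$ parts is a non-decreasing sequence of $m$ positive integers summing to $n$. For $n \geq 0$, $(a; q)_n = \prod_{j=1}^{n} (1 - a q^{j-1})$, with the empty product equal to $1$. -}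

module Defs where

open import Data.Nat as ℕ using (ℕ; zero; suc; _≤_; _≟_; _≤?_)
open import Data.Nat.Divisibility using (_∣_; _∣?_)
open import Data.Integer as ℤ using (ℤ; +_; -_)
open import Data.List using (List; []; _∷_; map; concatMap; upTo; filter; length)
open import Data.Nat.ListAction using (sum)
open import Data.List.Relation.Unary.All using (All)
open import Data.List.Relation.Unary.All.Properties using ()
import Data.List.Relation.Unary.All as All
open import Data.List.Relation.Unary.Linked using (Linked)
import Data.List.Relation.Unary.Linked as Linked
open import Data.Product using (_×_)
open import Data.Sum using (_⊎_)
open import Data.Bool using (if_then_else_)
open import Relation.Nullary using (¬_; Dec; does)
open import Relation.Nullary.Decidable using (_×-dec_; _⊎-dec_; ¬?)
open import Relation.Binary.PropositionalEquality using (_≡_; _≢_)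

Gap : ℕ → ℕ → Set
Gap x y = (x ℕ.+ 2 ≤ y) × ((3 ∣ x ℕ.+ y) ⊎ (x ℕ.+ 4 ≤ y))

gap? : ∀ x y → Dec (Gap x y)
gap? x y = (x ℕ.+ 2 ≤? y) ×-dec ((3 ∣? x ℕ.+ y) ⊎-dec (x ℕ.+ 4 ≤? y))

ValidCP2 : ℕ → List ℕ → Set
ValidCP2 n xs = (sum xs ≡ n) × (All (λ x → x ≢ 2) xs × Linked Gap xs)

validCP2? : ∀ n xs → Dec (ValidCP2 n xs)
validCP2? n xs = (sum xs ≟ n) ×-dec (All.all? (λ x → ¬? (x ≟ 2)) xs ×-dec Linked.linked? gap? xs)

lists : ℕ → ℕ → List (List ℕ)
lists n zero    = [] ∷ []
lists n (suc m) = concatMap (λ x → map (x ∷_) (lists n m)) (map suc (upTo n))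

-- every partition of n into m (positive) parts has all parts in {1,…,n},
-- so this counts exactly the partitions in question
cp₂ : ℕ → ℕ → ℕ
cp₂ n m = length (filter (validCP2? n) (lists n m))

Series : Set
Series = ℕ → ℤ

Σ≤ : ℕ → (ℕ → ℤ) → ℤ
Σ≤ zero    f = f zero
Σ≤ (suc N) f = Σ≤ N f ℤ.+ f (suc N)

mono : ℤ → ℕ → Series
mono c k i = if does (i ≟ k) then c else + 0

𝟙 : Series
𝟙 = mono (+ 1) 0

𝟘 : Series
𝟘 _ = + 0

_⊕_ : Series → Series → Series
(f ⊕ g) i = f i ℤ.+ g i

_⊖_ : Series → Series → Series
(f ⊖ g) i = f i ℤ.- g i

_⊛_ : Series → Series → Series
(f ⊛ g) n = Σ≤ n (λ i → f i ℤ.* g (n ℕ.∸ i))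

_^ˢ_ : Series → ℕ → Series
f ^ˢ zero  = 𝟙
f ^ˢ suc n = (f ^ˢ n) ⊛ f

poch : Series → Series → ℕ → Series
poch a q zero    = 𝟙
poch a q (suc n) = poch a q n ⊛ (𝟙 ⊖ (a ⊛ (q ^ˢ n)))

-- Multiplicative inverse of a series with constant term 1:
-- b₀ = 1,  b_k = - Σ_{j=1}^{k} a_j b_{k-j}.
-- invAux a N k = b_k for k ≤ N.
invAux : Series → ℕ → ℕ → ℤ
invAux a zero    k = if does (k ≟ 0) then + 1 else + 0
invAux a (suc N) k =
  if does (k ≤? N) then invAux a N k
  else - Σ≤ N (λ j → a (suc j) ℤ.* invAux a N (N ℕ.∸ j))

inv : Series → Series
inv a k = invAux a k k

q : Series
q = mono (+ 1) 1

-- Bivariate series in x, q:  F m = coefficient of x^m (a series in q)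

BiSeries : Set
BiSeries = ℕ → Series

xPow : ℕ → Series → BiSeries
xPow k f m = if does (m ≟ k) then f else 𝟘

_⊕ᴮ_ : BiSeries → BiSeries → BiSeries
(F ⊕ᴮ G) m = F m ⊕ G m

_⊛ᴮ_ : BiSeries → Series → BiSeries
(F ⊛ᴮ g) m = F m ⊛ g

term : ℕ → ℕ → BiSeries
term n₁ n₂ =
  (xPow d (mono (+ 1) e) ⊕ᴮ xPow (suc d) (mono (+ 1) (e ℕ.+ (3 ℕ.* n₂ ℕ.+ 2 ℕ.* n₁ ℕ.+ 1))))
  ⊛ᴮ inv (poch q q n₁ ⊛ poch (q ^ˢ 3) (q ^ˢ 3) n₂)
  where
  d = 2 ℕ.* n₂ ℕ.+ n₁
  e = 6 ℕ.* n₂ ℕ.* n₂ ℕ.+ 3 ℕ.* n₂ ℕ.+ 2 ℕ.* n₁ ℕ.* n₁ ℕ.+ n₁ ℕ.+ 6 ℕ.* n₂ ℕ.* n₁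

-- coefficient of x^m q^n in Σ_{n₁,n₂ ≥ 0} term n₁ n₂.
-- Only summands with 2n₂+n₁ ≤ m contribute to x^m (so n₁, n₂ ≤ m);
-- the infinite sum is therefore coefficientwise the finite sum below.
rhsCoeff : ℕ → ℕ → ℤ
rhsCoeff m n = Σ≤ m (λ n₁ → Σ≤ m (λ n₂ → term n₁ n₂ m n))

-- Write S(a, b) = Σ q^{Q(n₁,n₂) + a n₁ + b n₂} x^{n₁+2n₂} / ((q;q)_{n₁} (q³;q³)_{n₂}) with
-- Q(n₁,n₂) = 6n₂² + 3n₂ + 2n₁² + n₁ + 6n₁n₂. Splitting off the factor 1 − q^{n₁} resp. 1 − q^{3n₂} gives
--   S(a, b) − S(a+1, b) = x q^{a+3} S(a+4, b+6),    S(a, b) − S(a, b+3) = x² q^{b+9} S(a+6, b+12).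
-- For G_k = S(k−3, 2k−6+ε) with ε = 0, 1, −1 according to k mod 3 these combine into
--   G_k − G_{k+1} = x q^k · (G_{k+3}, G_{k+4} resp. G_{k+4} + G_{k+2} − G_{k+3}),
-- which is the recursion obtained for the partitions counted by cp₂ with smallest part ≥ k by splitting
-- off a smallest part k: the difference conditions say exactly which parts may follow k. Both sides
-- vanish for large k, so by induction on the number of parts G_k counts these partitions. The theorem
-- is G_3 + x q G_5: the first part is at least 3, or it is 1 and the remaining parts are at least 5.

module Submission where

open import Defs

open import Data.Bool using (if_then_else_; _∧_; _∨_)
open import Data.Bool.Properties using (if-float)
open import Data.Integer as ℤ using (ℤ; +_; -_; -[1+_]; _+_; _*_; _-_)
import Data.Integer.Properties as ℤP
open import Data.Integer.Tactic.RingSolver using (solve-∀; solve)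
open import Data.List using (List; []; _∷_; [_]; _++_; _∷ʳ_; map; concatMap; upTo; filter; length)
import Data.List.Properties as LP
open import Data.List.Relation.Unary.All as All using (All) renaming ([] to []ᴬ; _∷_ to _∷ᴬ_)
open import Data.List.Relation.Unary.Linked as Linked using (Linked; [-]) renaming ([] to []ᴸ; _∷_ to _∷ᴸ_)
open import Data.Nat as ℕ using (ℕ; zero; suc; z≤n; s≤s)
open import Data.Nat.Divisibility using (_∣_; m%n≡0⇒n∣m; n∣m⇒m%n≡0)
open import Data.Nat.DivMod using (_%_; %-distribˡ-+; m%n%n≡m%n; m%n<n; m*n%n≡0)
open import Data.Nat.ListAction using (sum)
open import Data.Nat.ListAction.Properties using (sum-++)
import Data.Nat.Properties as ℕP
import Data.Nat.Tactic.RingSolver as ℕ-Solver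
open import Data.Product using (_×_; _,_; proj₁; proj₂)
open import Data.Sum using (_⊎_; inj₁; inj₂)
open import Function.Bundles using (_⇔_; mk⇔; Equivalence)
open import Relation.Binary.PropositionalEquality hiding ([_])
open import Relation.Nullary using (Dec; yes; no; does; ¬_; contradiction)
open import Relation.Nullary.Decidable using (dec-true; dec-false; does-⇔; _×-dec_; _⊎-dec_; ¬?)
open import Relation.Unary using (Decidable)
open ≡-Reasoning

if-yes : ∀ {P A : Set} (P? : Dec P) {x y : A} → P → (if does P? then x else y) ≡ x
if-yes P? {x} {y} p = cong (λ b → if b then x else y) (dec-true P? p)

if-no : ∀ {P A : Set} (P? : Dec P) {x y : A} → ¬ P → (if does P? then x else y) ≡ y
if-no P? {x} {y} ¬p = cong (λ b → if b then x else y) (dec-false P? ¬p)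

Σ≤-cong : ∀ N {f g : ℕ → ℤ} → (∀ i → i ℕ.≤ N → f i ≡ g i) → Σ≤ N f ≡ Σ≤ N g
Σ≤-cong zero    eq = eq 0 z≤n
Σ≤-cong (suc N) eq =
  cong₂ _+_ (Σ≤-cong N (λ i i≤N → eq i (ℕP.m≤n⇒m≤1+n i≤N))) (eq (suc N) ℕP.≤-refl)

Σ≤-zero : ∀ N {f : ℕ → ℤ} → (∀ i → i ℕ.≤ N → f i ≡ + 0) → Σ≤ N f ≡ + 0
Σ≤-zero zero    eq = eq 0 z≤n
Σ≤-zero (suc N) eq =
  cong₂ _+_ (Σ≤-zero N (λ i i≤N → eq i (ℕP.m≤n⇒m≤1+n i≤N))) (eq (suc N) ℕP.≤-refl)

Σ≤-distrib-+ : ∀ N (f g : ℕ → ℤ) → Σ≤ N (λ i → f i + g i) ≡ Σ≤ N f + Σ≤ N g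
Σ≤-distrib-+ zero    f g = refl
Σ≤-distrib-+ (suc N) f g =
  trans (cong (_+ (f (suc N) + g (suc N))) (Σ≤-distrib-+ N f g))
        (middle-swap (Σ≤ N f) (Σ≤ N g) (f (suc N)) (g (suc N)))
  where
  middle-swap : ∀ a b c d → (a + b) + (c + d) ≡ (a + c) + (b + d)
  middle-swap = solve-∀

Σ≤-distrib-- : ∀ N (f g : ℕ → ℤ) → Σ≤ N (λ i → f i - g i) ≡ Σ≤ N f - Σ≤ N g
Σ≤-distrib-- zero    f g = refl
Σ≤-distrib-- (suc N) f g =
  trans (cong (_+ (f (suc N) - g (suc N))) (Σ≤-distrib-- N f g))
        (middle-swap (Σ≤ N f) (Σ≤ N g) (f (suc N)) (g (suc N)))
  where
  middle-swap : ∀ a b c d → (a - b) + (c - d) ≡ (a + c) - (b + d)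
  middle-swap = solve-∀

Σ≤-*ˡ : ∀ N c (f : ℕ → ℤ) → Σ≤ N (λ i → c * f i) ≡ c * Σ≤ N f
Σ≤-*ˡ zero    c f = refl
Σ≤-*ˡ (suc N) c f =
  trans (cong (_+ c * f (suc N)) (Σ≤-*ˡ N c f)) (sym (ℤP.*-distribˡ-+ c (Σ≤ N f) (f (suc N))))

Σ≤-*ʳ : ∀ N c (f : ℕ → ℤ) → Σ≤ N (λ i → f i * c) ≡ Σ≤ N f * c
Σ≤-*ʳ zero    c f = refl
Σ≤-*ʳ (suc N) c f =
  trans (cong (_+ f (suc N) * c) (Σ≤-*ʳ N c f)) (sym (ℤP.*-distribʳ-+ c (Σ≤ N f) (f (suc N))))

Σ≤-unfoldˡ : ∀ N (f : ℕ → ℤ) → Σ≤ (suc N) f ≡ f 0 + Σ≤ N (λ i → f (suc i))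
Σ≤-unfoldˡ zero    f = refl
Σ≤-unfoldˡ (suc N) f =
  trans (cong (_+ f (suc (suc N))) (Σ≤-unfoldˡ N f)) (ℤP.+-assoc (f 0) _ _)

Σ≤-single : ∀ N t {f : ℕ → ℤ} → t ℕ.≤ N → (∀ i → i ℕ.≤ N → i ≢ t → f i ≡ + 0) → Σ≤ N f ≡ f t
Σ≤-single zero    .zero z≤n _ = refl
Σ≤-single (suc N) t {f} t≤1+N others with t ℕ.≤? N
... | yes t≤N =
  trans (cong₂ _+_ (Σ≤-single N t t≤N (λ i i≤N → others i (ℕP.m≤n⇒m≤1+n i≤N)))
                   (others (suc N) ℕP.≤-refl (λ { refl → ℕP.1+n≰n t≤N })))
        (ℤP.+-identityʳ (f t))
... | no t≰N with refl ← ℕP.≤-antisym t≤1+N (ℕP.≰⇒> t≰N) =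
  trans (cong (_+ f (suc N)) (Σ≤-zero N (λ i i≤N → others i (ℕP.m≤n⇒m≤1+n i≤N) (λ { refl → ℕP.1+n≰n i≤N }))))
        (ℤP.+-identityˡ (f (suc N)))

Σ≤-reverse : ∀ N (f : ℕ → ℤ) → Σ≤ N f ≡ Σ≤ N (λ i → f (N ℕ.∸ i))
Σ≤-reverse zero    f = refl
Σ≤-reverse (suc N) f = begin
  Σ≤ N f + f (suc N)                    ≡⟨ cong (_+ f (suc N)) (Σ≤-reverse N f) ⟩
  Σ≤ N (λ i → f (N ℕ.∸ i)) + f (suc N)  ≡⟨ ℤP.+-comm _ (f (suc N)) ⟩
  f (suc N) + Σ≤ N (λ i → f (N ℕ.∸ i))  ≡⟨ Σ≤-unfoldˡ N (λ i → f (suc N ℕ.∸ i)) ⟨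
  Σ≤ (suc N) (λ i → f (suc N ℕ.∸ i))    ∎

Σ≤-comm : ∀ M N (f : ℕ → ℕ → ℤ) → Σ≤ M (λ i → Σ≤ N (f i)) ≡ Σ≤ N (λ j → Σ≤ M (λ i → f i j))
Σ≤-comm zero    N f = refl
Σ≤-comm (suc M) N f =
  trans (cong (_+ Σ≤ N (f (suc M))) (Σ≤-comm M N f))
        (sym (Σ≤-distrib-+ N (λ j → Σ≤ M (λ i → f i j)) (f (suc M))))

Σ≤-triangle : ∀ N (F : ℕ → ℕ → ℤ) →
  Σ≤ N (λ i → Σ≤ i (F i)) ≡ Σ≤ N (λ j → Σ≤ (N ℕ.∸ j) (λ l → F (j ℕ.+ l) j))
Σ≤-triangle zero    F = refl
Σ≤-triangle (suc N) F = begin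
  Σ≤ N (λ i → Σ≤ i (F i)) + (Σ≤ N (F (suc N)) + F (suc N) (suc N))
    ≡⟨ cong (_+ Σ≤ (suc N) (F (suc N))) (Σ≤-triangle N F) ⟩
  Σ≤ N slice + (Σ≤ N (F (suc N)) + F (suc N) (suc N))
    ≡⟨ ℤP.+-assoc (Σ≤ N slice) (Σ≤ N (F (suc N))) _ ⟨
  (Σ≤ N slice + Σ≤ N (F (suc N))) + F (suc N) (suc N)
    ≡⟨ cong (_+ F (suc N) (suc N)) (Σ≤-distrib-+ N slice (F (suc N))) ⟨
  Σ≤ N (λ j → slice j + F (suc N) j) + F (suc N) (suc N)
    ≡⟨ cong₂ _+_ (Σ≤-cong N (λ j j≤N → sym (extend-slice j j≤N)))
                 (cong (λ i → F i (suc N)) (sym (ℕP.+-identityʳ (suc N)))) ⟩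
  Σ≤ N slice′ + F (suc N ℕ.+ 0) (suc N)
    ≡⟨ cong (λ k → Σ≤ N slice′ + Σ≤ k (λ l → F (suc N ℕ.+ l) (suc N))) (ℕP.n∸n≡0 N) ⟨
  Σ≤ N slice′ + Σ≤ (N ℕ.∸ N) (λ l → F (suc N ℕ.+ l) (suc N)) ∎
  where
  slice slice′ : ℕ → ℤ
  slice  j = Σ≤ (N ℕ.∸ j) (λ l → F (j ℕ.+ l) j)
  slice′ j = Σ≤ (suc N ℕ.∸ j) (λ l → F (j ℕ.+ l) j)
  extend-slice : ∀ j → j ℕ.≤ N → slice′ j ≡ slice j + F (suc N) j
  extend-slice j j≤N rewrite ℕP.+-∸-assoc 1 j≤N =
    cong (λ i → slice j + F i j) (trans (ℕP.+-suc j (N ℕ.∸ j)) (cong suc (ℕP.m+[n∸m]≡n j≤N)))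

infix 4 _≈_

_≈_ : Series → Series → Set
f ≈ g = ∀ i → f i ≡ g i

⊛-cong : ∀ {f f′ g g′} → f ≈ f′ → g ≈ g′ → (f ⊛ g) ≈ (f′ ⊛ g′)
⊛-cong f≈f′ g≈g′ n = Σ≤-cong n (λ i _ → cong₂ _*_ (f≈f′ i) (g≈g′ (n ℕ.∸ i)))

⊛-congˡ : ∀ {f f′} g → f ≈ f′ → (f ⊛ g) ≈ (f′ ⊛ g)
⊛-congˡ g f≈f′ = ⊛-cong f≈f′ (λ i → refl {x = g i})

⊛-congʳ : ∀ f {g g′} → g ≈ g′ → (f ⊛ g) ≈ (f ⊛ g′)
⊛-congʳ f g≈g′ = ⊛-cong (λ i → refl {x = f i}) g≈g′

⊛-comm : ∀ f g → (f ⊛ g) ≈ (g ⊛ f)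
⊛-comm f g n = begin
  Σ≤ n (λ i → f i * g (n ℕ.∸ i))                      ≡⟨ Σ≤-reverse n _ ⟩
  Σ≤ n (λ i → f (n ℕ.∸ i) * g (n ℕ.∸ (n ℕ.∸ i)))      ≡⟨ Σ≤-cong n swap ⟩
  Σ≤ n (λ i → g i * f (n ℕ.∸ i))                      ∎
  where
  swap : ∀ i → i ℕ.≤ n → f (n ℕ.∸ i) * g (n ℕ.∸ (n ℕ.∸ i)) ≡ g i * f (n ℕ.∸ i)
  swap i i≤n rewrite ℕP.m∸[m∸n]≡n i≤n = ℤP.*-comm (f (n ℕ.∸ i)) (g i)

⊛-assoc : ∀ f g h → ((f ⊛ g) ⊛ h) ≈ (f ⊛ (g ⊛ h))
⊛-assoc f g h n = begin
  Σ≤ n (λ i → Σ≤ i (λ j → f j * g (i ℕ.∸ j)) * h (n ℕ.∸ i))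
    ≡⟨ Σ≤-cong n (λ i _ → sym (Σ≤-*ʳ i (h (n ℕ.∸ i)) _)) ⟩
  Σ≤ n (λ i → Σ≤ i (λ j → f j * g (i ℕ.∸ j) * h (n ℕ.∸ i)))
    ≡⟨ Σ≤-triangle n (λ i j → f j * g (i ℕ.∸ j) * h (n ℕ.∸ i)) ⟩
  Σ≤ n (λ j → Σ≤ (n ℕ.∸ j) (λ l → f j * g (j ℕ.+ l ℕ.∸ j) * h (n ℕ.∸ (j ℕ.+ l))))
    ≡⟨ Σ≤-cong n (λ j _ → Σ≤-cong (n ℕ.∸ j) (λ l _ → reindex j l)) ⟩
  Σ≤ n (λ j → Σ≤ (n ℕ.∸ j) (λ l → f j * (g l * h (n ℕ.∸ j ℕ.∸ l))))
    ≡⟨ Σ≤-cong n (λ j _ → Σ≤-*ˡ (n ℕ.∸ j) (f j) _) ⟩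
  Σ≤ n (λ j → f j * Σ≤ (n ℕ.∸ j) (λ l → g l * h (n ℕ.∸ j ℕ.∸ l))) ∎
  where
  reindex : ∀ j l → f j * g (j ℕ.+ l ℕ.∸ j) * h (n ℕ.∸ (j ℕ.+ l)) ≡ f j * (g l * h (n ℕ.∸ j ℕ.∸ l))
  reindex j l rewrite ℕP.m+n∸m≡n j l | ℕP.∸-+-assoc n j l = ℤP.*-assoc (f j) (g l) _

⊛-distribˡ-⊖ : ∀ f g h → (f ⊛ (g ⊖ h)) ≈ ((f ⊛ g) ⊖ (f ⊛ h))
⊛-distribˡ-⊖ f g h n =
  trans (Σ≤-cong n (λ i _ → distrib (f i) (g (n ℕ.∸ i)) (h (n ℕ.∸ i)))) (Σ≤-distrib-- n _ _)
  where
  distrib : ∀ a b c → a * (b - c) ≡ a * b - a * c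
  distrib = solve-∀

⊛-distribʳ-⊕ : ∀ f g h → ((f ⊕ g) ⊛ h) ≈ ((f ⊛ h) ⊕ (g ⊛ h))
⊛-distribʳ-⊕ f g h n =
  trans (Σ≤-cong n (λ i _ → ℤP.*-distribʳ-+ (h (n ℕ.∸ i)) (f i) (g i))) (Σ≤-distrib-+ n _ _)

-- The coefficient of q^z for an integer exponent z; negative exponents have coefficient 0.
extend : Series → ℤ → ℤ
extend f (+ k)     = f k
extend f -[1+ _ ]  = + 0

minus-≥ : ∀ {k j} → j ℕ.≤ k → + k - + j ≡ + (k ℕ.∸ j)
minus-≥ {k} {j} j≤k = trans (ℤP.m-n≡m⊖n k j) (ℤP.⊖-≥ j≤k)

extend-below : ∀ f {z w} → z ℤ.< + w → extend f (z - + w) ≡ + 0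
extend-below f { -[1+ t ]} {w} ℤ.-<+ = cong (extend f) (ℤP.neg-minus-pos t w)
extend-below f {+ n} {w} (ℤ.+<+ n<w)
  rewrite ℤP.m-n≡m⊖n n w | ℤP.⊖-< n<w with w ℕ.∸ n | ℕP.m>n⇒m∸n≢0 n<w
... | zero  | w∸n≢0 = contradiction refl w∸n≢0
... | suc _ | _     = refl

mono-≡ : ∀ c j → mono c j j ≡ c
mono-≡ c j = if-yes (j ℕ.≟ j) refl

mono-≢ : ∀ c j {i} → i ≢ j → mono c j i ≡ + 0
mono-≢ c j {i} i≢j = if-no (i ℕ.≟ j) i≢j

⊛-monomial : ∀ f j → (f ⊛ mono (+ 1) j) ≈ (λ k → extend f (+ k - + j))
⊛-monomial f j k with j ℕ.≤? k
... | yes j≤k = begin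
  Σ≤ k (λ i → f i * mono (+ 1) j (k ℕ.∸ i))
    ≡⟨ Σ≤-single k (k ℕ.∸ j) (ℕP.m∸n≤m k j) off-diagonal ⟩
  f (k ℕ.∸ j) * mono (+ 1) j (k ℕ.∸ (k ℕ.∸ j))
    ≡⟨ cong (λ i → f (k ℕ.∸ j) * mono (+ 1) j i) (ℕP.m∸[m∸n]≡n j≤k) ⟩
  f (k ℕ.∸ j) * mono (+ 1) j j
    ≡⟨ trans (cong (f (k ℕ.∸ j) *_) (mono-≡ (+ 1) j)) (ℤP.*-identityʳ _) ⟩
  f (k ℕ.∸ j)
    ≡⟨ cong (extend f) (minus-≥ j≤k) ⟨
  extend f (+ k - + j) ∎
  where
  off-diagonal : ∀ i → i ℕ.≤ k → i ≢ k ℕ.∸ j → f i * mono (+ 1) j (k ℕ.∸ i) ≡ + 0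
  off-diagonal i i≤k i≢k∸j =
    trans (cong (f i *_) (mono-≢ (+ 1) j {k ℕ.∸ i} (λ k∸i≡j → i≢k∸j
            (trans (sym (ℕP.m∸[m∸n]≡n i≤k)) (cong (k ℕ.∸_) k∸i≡j)))))
          (ℤP.*-zeroʳ (f i))
... | no j≰k = trans (Σ≤-zero k vanish) (sym (extend-below f (ℤ.+<+ (ℕP.≰⇒> j≰k))))
  where
  vanish : ∀ i → i ℕ.≤ k → f i * mono (+ 1) j (k ℕ.∸ i) ≡ + 0
  vanish i _ = trans (cong (f i *_) (mono-≢ (+ 1) j (λ k∸i≡j → j≰k
                 (subst (ℕ._≤ k) k∸i≡j (ℕP.m∸n≤m k i)))))
                 (ℤP.*-zeroʳ (f i))

⊛-identityʳ : ∀ f → (f ⊛ 𝟙) ≈ f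
⊛-identityʳ f k = trans (⊛-monomial f 0 k) (cong (extend f) (ℤP.+-identityʳ (+ k)))

⊛-identityˡ : ∀ f → (𝟙 ⊛ f) ≈ f
⊛-identityˡ f k = trans (⊛-comm 𝟙 f k) (⊛-identityʳ f k)

monomial-⊛-monomial : ∀ i j → (mono (+ 1) i ⊛ mono (+ 1) j) ≈ mono (+ 1) (i ℕ.+ j)
monomial-⊛-monomial i j k with j ℕ.≤? k
... | yes j≤k = trans (⊛-monomial (mono (+ 1) i) j k) (trans (cong (extend (mono (+ 1) i)) (minus-≥ j≤k))
                  (cong (λ b → if b then + 1 else + 0) (does-⇔ (mk⇔ to from) (k ℕ.∸ j ℕ.≟ i) (k ℕ.≟ i ℕ.+ j))))
  where
  to : k ℕ.∸ j ≡ i → k ≡ i ℕ.+ j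
  to k∸j≡i = trans (sym (ℕP.m∸n+n≡m j≤k)) (cong (ℕ._+ j) k∸j≡i)
  from : k ≡ i ℕ.+ j → k ℕ.∸ j ≡ i
  from k≡i+j = trans (cong (ℕ._∸ j) k≡i+j) (ℕP.m+n∸n≡m i j)
... | no j≰k = trans (⊛-monomial (mono (+ 1) i) j k) (trans (extend-below (mono (+ 1) i) (ℤ.+<+ (ℕP.≰⇒> j≰k)))
                 (sym (mono-≢ (+ 1) (i ℕ.+ j) (λ k≡i+j → j≰k (subst (j ℕ.≤_) (sym k≡i+j) (ℕP.m≤n+m j i))))))

⊛-right-comm : ∀ f g h → ((f ⊛ g) ⊛ h) ≈ ((f ⊛ h) ⊛ g)
⊛-right-comm f g h k = begin
  ((f ⊛ g) ⊛ h) k  ≡⟨ ⊛-assoc f g h k ⟩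
  (f ⊛ (g ⊛ h)) k  ≡⟨ ⊛-congʳ f (⊛-comm g h) k ⟩
  (f ⊛ (h ⊛ g)) k  ≡⟨ ⊛-assoc f h g k ⟨
  ((f ⊛ h) ⊛ g) k  ∎

^ˢ-monomial : ∀ {a} c → a ≈ mono (+ 1) c → ∀ n → (a ^ˢ n) ≈ mono (+ 1) (n ℕ.* c)
^ˢ-monomial c a≈q^c zero    k = refl
^ˢ-monomial c a≈q^c (suc n) k =
  trans (⊛-cong (^ˢ-monomial c a≈q^c n) a≈q^c k)
        (trans (monomial-⊛-monomial (n ℕ.* c) c k) (cong (λ e → mono (+ 1) e k) (ℕP.+-comm (n ℕ.* c) c)))

inv-suc : ∀ a N → inv a (suc N) ≡ - Σ≤ N (λ j → a (suc j) * invAux a N (N ℕ.∸ j))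
inv-suc a N = if-no (suc N ℕ.≤? N) (ℕP.<-irrefl refl)

inv-stable : ∀ a N k → k ℕ.≤ N → invAux a N k ≡ inv a k
inv-stable a zero    .zero z≤n = refl
inv-stable a (suc N) k k≤1+N with k ℕ.≤? N
... | yes k≤N = trans (if-yes (k ℕ.≤? N) k≤N) (inv-stable a N k k≤N)
... | no k≰N with refl ← ℕP.≤-antisym k≤1+N (ℕP.≰⇒> k≰N) = refl

⊛-inverseʳ : ∀ a → a 0 ≡ + 1 → (a ⊛ inv a) ≈ 𝟙
⊛-inverseʳ a a₀≡1 zero    = cong (_* + 1) a₀≡1
⊛-inverseʳ a a₀≡1 (suc N) = begin
  Σ≤ (suc N) (λ i → a i * inv a (suc N ℕ.∸ i))
    ≡⟨ Σ≤-unfoldˡ N (λ i → a i * inv a (suc N ℕ.∸ i)) ⟩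
  a 0 * inv a (suc N) + Σ≤ N (λ i → a (suc i) * inv a (N ℕ.∸ i))
    ≡⟨ cong₂ _+_ (cong₂ _*_ a₀≡1 (inv-suc a N))
                 (Σ≤-cong N (λ i _ → cong (a (suc i) *_) (sym (inv-stable a N (N ℕ.∸ i) (ℕP.m∸n≤m N i))))) ⟩
  + 1 * - R + R
    ≡⟨ cancel R ⟩
  + 0 ∎
  where
  R = Σ≤ N (λ j → a (suc j) * invAux a N (N ℕ.∸ j))
  cancel : ∀ x → + 1 * - x + x ≡ + 0
  cancel = solve-∀

inverse-unique : ∀ a b → a 0 ≡ + 1 → (a ⊛ b) ≈ 𝟙 → b ≈ inv a
inverse-unique a b a₀≡1 ab≈1 n = begin
  b n                    ≡⟨ ⊛-identityˡ b n ⟨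
  (𝟙 ⊛ b) n              ≡⟨ ⊛-congˡ b inv-a·a≈1 n ⟨
  ((inv a ⊛ a) ⊛ b) n    ≡⟨ ⊛-assoc (inv a) a b n ⟩
  (inv a ⊛ (a ⊛ b)) n    ≡⟨ ⊛-congʳ (inv a) ab≈1 n ⟩
  (inv a ⊛ 𝟙) n          ≡⟨ ⊛-identityʳ (inv a) n ⟩
  inv a n                ∎
  where
  inv-a·a≈1 : (inv a ⊛ a) ≈ 𝟙
  inv-a·a≈1 k = trans (⊛-comm (inv a) a k) (⊛-inverseʳ a a₀≡1 k)

inv-factor : ∀ X Y j → X 0 ≡ + 1 → Y 0 ≡ + 1 → Y ≈ (X ⊛ (𝟙 ⊖ mono (+ 1) j)) →
             inv X ≈ (inv Y ⊛ (𝟙 ⊖ mono (+ 1) j))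
inv-factor X Y j X₀≡1 Y₀≡1 Y≈X·D = λ k → sym (inverse-unique X (inv Y ⊛ D) X₀≡1 X·B≈1 k)
  where
  D = 𝟙 ⊖ mono (+ 1) j
  X·B≈1 : (X ⊛ (inv Y ⊛ D)) ≈ 𝟙
  X·B≈1 k = begin
    (X ⊛ (inv Y ⊛ D)) k  ≡⟨ ⊛-congʳ X (⊛-comm (inv Y) D) k ⟩
    (X ⊛ (D ⊛ inv Y)) k  ≡⟨ ⊛-assoc X D (inv Y) k ⟨
    ((X ⊛ D) ⊛ inv Y) k  ≡⟨ ⊛-congˡ (inv Y) (λ i → sym (Y≈X·D i)) k ⟩
    (Y ⊛ inv Y) k        ≡⟨ ⊛-inverseʳ Y Y₀≡1 k ⟩
    𝟙 k                  ∎

extend-inv-factor : ∀ X Y j → X 0 ≡ + 1 → Y 0 ≡ + 1 → Y ≈ (X ⊛ (𝟙 ⊖ mono (+ 1) j)) →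
                    ∀ z → extend (inv X) z ≡ extend (inv Y) z - extend (inv Y) (z - + j)
extend-inv-factor X Y j X₀≡1 Y₀≡1 Y≈X·D (+ k) = begin
  inv X k                                            ≡⟨ inv-factor X Y j X₀≡1 Y₀≡1 Y≈X·D k ⟩
  (inv Y ⊛ (𝟙 ⊖ mono (+ 1) j)) k                     ≡⟨ ⊛-distribˡ-⊖ (inv Y) 𝟙 (mono (+ 1) j) k ⟩
  (inv Y ⊛ 𝟙) k - (inv Y ⊛ mono (+ 1) j) k           ≡⟨ cong₂ _-_ (⊛-identityʳ (inv Y) k) (⊛-monomial (inv Y) j k) ⟩
  inv Y k - extend (inv Y) (+ k - + j)               ∎
extend-inv-factor X Y j _ _ _ -[1+ t ] = sym (cong (_-_ (+ 0)) (extend-below (inv Y) {w = j} ℤ.-<+))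

poch-monomial-suc : ∀ {a} c → a ≈ mono (+ 1) c → ∀ n →
                    poch a a (suc n) ≈ (poch a a n ⊛ (𝟙 ⊖ mono (+ 1) (suc n ℕ.* c)))
poch-monomial-suc {a} c a≈q^c n =
  ⊛-congʳ (poch a a n)
          (λ k → cong (_-_ (𝟙 k)) (trans (⊛-cong a≈q^c (^ˢ-monomial c a≈q^c n) k) (monomial-⊛-monomial c (n ℕ.* c) k)))

poch-const : ∀ a → a 0 ≡ + 0 → ∀ n → poch a a n 0 ≡ + 1
poch-const a a₀≡0 zero    = refl
poch-const a a₀≡0 (suc n) = cong₂ (λ x y → x * (+ 1 - y * (a ^ˢ n) 0)) (poch-const a a₀≡0 n) a₀≡0

q³≈ : (q ^ˢ 3) ≈ mono (+ 1) 3
q³≈ = ^ˢ-monomial 1 (λ _ → refl) 3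

denom : ℕ → ℕ → Series
denom n₁ n₂ = poch q q n₁ ⊛ poch (q ^ˢ 3) (q ^ˢ 3) n₂

denom-const : ∀ n₁ n₂ → denom n₁ n₂ 0 ≡ + 1
denom-const n₁ n₂ = cong₂ _*_ (poch-const q refl n₁) (poch-const (q ^ˢ 3) (q³≈ 0) n₂)

denom-suc₁ : ∀ n₁ n₂ → denom (suc n₁) n₂ ≈ (denom n₁ n₂ ⊛ (𝟙 ⊖ mono (+ 1) (suc n₁)))
denom-suc₁ n₁ n₂ k = begin
  (poch q q (suc n₁) ⊛ P₂) k              ≡⟨ ⊛-congˡ P₂ (poch-monomial-suc 1 (λ _ → refl) n₁) k ⟩
  ((poch q q n₁ ⊛ D) ⊛ P₂) k              ≡⟨ ⊛-right-comm (poch q q n₁) D P₂ k ⟩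
  ((poch q q n₁ ⊛ P₂) ⊛ D) k              ≡⟨ cong (λ e → ((poch q q n₁ ⊛ P₂) ⊛ (𝟙 ⊖ mono (+ 1) e)) k)
                                                  (ℕP.*-identityʳ (suc n₁)) ⟩
  (denom n₁ n₂ ⊛ (𝟙 ⊖ mono (+ 1) (suc n₁))) k ∎
  where
  P₂ = poch (q ^ˢ 3) (q ^ˢ 3) n₂
  D  = 𝟙 ⊖ mono (+ 1) (suc n₁ ℕ.* 1)

denom-suc₂ : ∀ n₁ n₂ → denom n₁ (suc n₂) ≈ (denom n₁ n₂ ⊛ (𝟙 ⊖ mono (+ 1) (suc n₂ ℕ.* 3)))
denom-suc₂ n₁ n₂ k = begin
  (poch q q n₁ ⊛ poch (q ^ˢ 3) (q ^ˢ 3) (suc n₂)) k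
    ≡⟨ ⊛-congʳ (poch q q n₁) (poch-monomial-suc 3 q³≈ n₂) k ⟩
  (poch q q n₁ ⊛ (poch (q ^ˢ 3) (q ^ˢ 3) n₂ ⊛ (𝟙 ⊖ mono (+ 1) (suc n₂ ℕ.* 3)))) k
    ≡⟨ ⊛-assoc (poch q q n₁) (poch (q ^ˢ 3) (q ^ˢ 3) n₂) (𝟙 ⊖ mono (+ 1) (suc n₂ ℕ.* 3)) k ⟨
  (denom n₁ n₂ ⊛ (𝟙 ⊖ mono (+ 1) (suc n₂ ℕ.* 3))) k ∎

ρ : ℕ → ℕ → ℤ → ℤ
ρ n₁ n₂ = extend (inv (denom n₁ n₂))

ρ-suc₁ : ∀ n₁ n₂ z → ρ n₁ n₂ z ≡ ρ (suc n₁) n₂ z - ρ (suc n₁) n₂ (z - + suc n₁)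
ρ-suc₁ n₁ n₂ = extend-inv-factor (denom n₁ n₂) (denom (suc n₁) n₂) (suc n₁)
                 (denom-const n₁ n₂) (denom-const (suc n₁) n₂) (denom-suc₁ n₁ n₂)

ρ-suc₂ : ∀ n₁ n₂ z → ρ n₁ n₂ z ≡ ρ n₁ (suc n₂) z - ρ n₁ (suc n₂) (z - + (suc n₂ ℕ.* 3))
ρ-suc₂ n₁ n₂ = extend-inv-factor (denom n₁ n₂) (denom n₁ (suc n₂)) (suc n₂ ℕ.* 3)
                 (denom-const n₁ n₂) (denom-const n₁ (suc n₂)) (denom-suc₂ n₁ n₂)

ρ-0-0 : ∀ k → ρ 0 0 (+ k) ≡ 𝟙 k
ρ-0-0 k = sym (inverse-unique (denom 0 0) 𝟙 refl (λ i → trans (⊛-identityʳ (denom 0 0) i) (⊛-identityʳ 𝟙 i)) k)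

-- F m z is the coefficient of x^m q^z.
Coeffs : Set
Coeffs = ℕ → ℤ → ℤ

-- Multiplication by x^d q^j.
xq : ℕ → ℤ → Coeffs → Coeffs
xq zero    j F m       z = F m (z - j)
xq (suc d) j F zero    z = + 0
xq (suc d) j F (suc m) z = xq d j F m z

xq-cong : ∀ d {j j′} {F F′ : Coeffs} → j ≡ j′ → (∀ m z → F m z ≡ F′ m z) → ∀ m z → xq d j F m z ≡ xq d j′ F′ m z
xq-cong zero    refl F≡F′ m       z = F≡F′ m _
xq-cong (suc d) j≡j′ F≡F′ zero    z = refl
xq-cong (suc d) j≡j′ F≡F′ (suc m) z = xq-cong d j≡j′ F≡F′ m z

xq-shift : ∀ d i j F m z → xq d j F m (z - i) ≡ xq d (i + j) F m z
xq-shift zero    i j F m       z = cong (F m) (reassoc z i j)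
  where
  reassoc : ∀ z i j → z - i - j ≡ z - (i + j)
  reassoc = solve-∀
xq-shift (suc d) i j F zero    z = refl
xq-shift (suc d) i j F (suc m) z = xq-shift d i j F m z

xq-xq : ∀ d e i j F m z → xq d i (xq e j F) m z ≡ xq (d ℕ.+ e) (i + j) F m z
xq-xq zero    e i j F m       z = xq-shift e i j F m z
xq-xq (suc d) e i j F zero    z = refl
xq-xq (suc d) e i j F (suc m) z = xq-xq d e i j F m z

xq-distrib-- : ∀ d j F G m z → xq d j F m z - xq d j G m z ≡ xq d j (λ m z → F m z - G m z) m z
xq-distrib-- zero    j F G m       z = refl
xq-distrib-- (suc d) j F G zero    z = refl
xq-distrib-- (suc d) j F G (suc m) z = xq-distrib-- d j F G m z

-- Σdiag f m = Σ_{n₁ + 2 n₂ = m} f n₁ n₂.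
Σdiag : (ℕ → ℕ → ℤ) → ℕ → ℤ
Σdiag f zero          = f 0 0
Σdiag f (suc zero)    = f 1 0
Σdiag f (suc (suc m)) = f (suc (suc m)) 0 + Σdiag (λ n₁ n₂ → f n₁ (suc n₂)) m

Σdiag-cong : ∀ {f g} → (∀ n₁ n₂ → f n₁ n₂ ≡ g n₁ n₂) → ∀ m → Σdiag f m ≡ Σdiag g m
Σdiag-cong f≡g zero          = f≡g 0 0
Σdiag-cong f≡g (suc zero)    = f≡g 1 0
Σdiag-cong f≡g (suc (suc m)) = cong₂ _+_ (f≡g (suc (suc m)) 0) (Σdiag-cong (λ n₁ n₂ → f≡g n₁ (suc n₂)) m)

Σdiag-distrib-- : ∀ f g m → Σdiag (λ n₁ n₂ → f n₁ n₂ - g n₁ n₂) m ≡ Σdiag f m - Σdiag g m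
Σdiag-distrib-- f g zero          = refl
Σdiag-distrib-- f g (suc zero)    = refl
Σdiag-distrib-- f g (suc (suc m)) =
  trans (cong (_+_ (f (suc (suc m)) 0 - g (suc (suc m)) 0)) (Σdiag-distrib-- _ _ m))
        (middle-swap (f (suc (suc m)) 0) (g (suc (suc m)) 0) _ _)
  where
  middle-swap : ∀ a b c d → (a - b) + (c - d) ≡ (a + c) - (b + d)
  middle-swap = solve-∀

Σdiag-suc : ∀ f → (∀ n₂ → f 0 n₂ ≡ + 0) → ∀ m → Σdiag f (suc m) ≡ Σdiag (λ n₁ → f (suc n₁)) m
Σdiag-suc f f₀≡0 zero          = refl
Σdiag-suc f f₀≡0 (suc zero)    = trans (cong (_+_ (f 2 0)) (f₀≡0 1)) (ℤP.+-identityʳ (f 2 0))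
Σdiag-suc f f₀≡0 (suc (suc m)) =
  cong (_+_ (f (3 ℕ.+ m) 0)) (Σdiag-suc (λ n₁ n₂ → f n₁ (suc n₂)) (λ n₂ → f₀≡0 (suc n₂)) m)

diagonal-suc : ∀ n₁ n₂ → n₁ ℕ.+ 2 ℕ.* suc n₂ ≡ 2 ℕ.+ (n₁ ℕ.+ 2 ℕ.* n₂)
diagonal-suc n₁ n₂ =
  trans (cong (n₁ ℕ.+_) (ℕP.*-suc 2 n₂)) (trans (ℕP.+-suc n₁ _) (cong suc (ℕP.+-suc n₁ _)))

Σdiag-zero : ∀ f m → (∀ n₁ n₂ → n₁ ℕ.+ 2 ℕ.* n₂ ≡ m → f n₁ n₂ ≡ + 0) → Σdiag f m ≡ + 0
Σdiag-zero f zero          f≡0 = f≡0 0 0 refl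
Σdiag-zero f (suc zero)    f≡0 = f≡0 1 0 refl
Σdiag-zero f (suc (suc m)) f≡0 =
  cong₂ _+_ (f≡0 (suc (suc m)) 0 (ℕP.+-identityʳ (suc (suc m))))
            (Σdiag-zero _ m (λ n₁ n₂ n₁+2n₂≡m → f≡0 n₁ (suc n₂) (trans (diagonal-suc n₁ n₂) (cong (2 ℕ.+_) n₁+2n₂≡m))))

-- The double sums and their q-difference equations

Q : ℤ → ℤ → ℤ
Q x y = + 6 * y * y + + 3 * y + + 2 * x * x + x + + 6 * y * x

Q-suc₁ : ∀ x y → Q (+ 1 + x) y ≡ Q x y + + 4 * x + + 6 * y + + 3
Q-suc₁ = expanded
  where
  expanded : ∀ x y → + 6 * y * y + + 3 * y + + 2 * (+ 1 + x) * (+ 1 + x) + (+ 1 + x) + + 6 * y * (+ 1 + x)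
                   ≡ (+ 6 * y * y + + 3 * y + + 2 * x * x + x + + 6 * y * x) + + 4 * x + + 6 * y + + 3
  expanded = solve-∀

Q-suc₂ : ∀ x y → Q x (+ 1 + y) ≡ Q x y + + 6 * x + + 12 * y + + 9
Q-suc₂ = expanded
  where
  expanded : ∀ x y → + 6 * (+ 1 + y) * (+ 1 + y) + + 3 * (+ 1 + y) + + 2 * x * x + x + + 6 * (+ 1 + y) * x
                   ≡ (+ 6 * y * y + + 3 * y + + 2 * x * x + x + + 6 * y * x) + + 6 * x + + 12 * y + + 9
  expanded = solve-∀

T : ℤ → ℤ → ℕ → ℕ → ℤ → ℤ
T a b n₁ n₂ z = ρ n₁ n₂ (z - Q (+ n₁) (+ n₂) - a * + n₁ - b * + n₂)

S : ℤ → ℤ → Coeffs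
S a b m z = Σdiag (λ n₁ n₂ → T a b n₁ n₂ z) m

-- The offsets i, j are natural numbers so that composing these equations needs no index arithmetic.
S-diff-a : ∀ a b i j m z →
  S (a + + i) (b + + j) m z - S (a + + (1 ℕ.+ i)) (b + + j) m z
    ≡ xq 1 (a + + (3 ℕ.+ i)) (S (a + + (4 ℕ.+ i)) (b + + (6 ℕ.+ j))) m z
S-diff-a a b i j m z = trans (sym (Σdiag-distrib-- _ _ m)) (diagonal m)
  where
  A  = a + + i
  A′ = a + + (1 ℕ.+ i)
  B  = b + + j

  no-n₁ : ∀ n₂ → T A B 0 n₂ z - T A′ B 0 n₂ z ≡ + 0
  no-n₁ n₂ = trans (cong (λ t → T A B 0 n₂ z - ρ 0 n₂ t) (sym (drop-a z (Q (+ 0) (+ n₂)) A A′ B (+ n₂))))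
                   (ℤP.+-inverseʳ (T A B 0 n₂ z))
    where
    drop-a : ∀ z w a a′ b y → z - w - a * + 0 - b * y ≡ z - w - a′ * + 0 - b * y
    drop-a = solve-∀

  step : ∀ n₁ n₂ → T A B (suc n₁) n₂ z - T A′ B (suc n₁) n₂ z
                 ≡ T (a + + (4 ℕ.+ i)) (b + + (6 ℕ.+ j)) n₁ n₂ (z - (a + + (3 ℕ.+ i)))
  step n₁ n₂ = begin
    ρ (suc n₁) n₂ Z - ρ (suc n₁) n₂ (z - Q x′ y - A′ * x′ - B * y)
      ≡⟨ cong (λ t → ρ (suc n₁) n₂ Z - ρ (suc n₁) n₂ t) (peel z (Q x′ y) a (+ i) x B y) ⟩
    ρ (suc n₁) n₂ Z - ρ (suc n₁) n₂ (Z - + suc n₁)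
      ≡⟨ ρ-suc₁ n₁ n₂ Z ⟨
    ρ n₁ n₂ Z
      ≡⟨ cong (ρ n₁ n₂) (trans (cong (λ w → z - w - A * x′ - B * y) (Q-suc₁ x y)) (shift z (Q x y) a (+ i) b (+ j) x y)) ⟩
    T (a + + (4 ℕ.+ i)) (b + + (6 ℕ.+ j)) n₁ n₂ (z - (a + + (3 ℕ.+ i))) ∎
    where
    x  = + n₁
    x′ = + suc n₁
    y  = + n₂
    Z  = z - Q x′ y - A * x′ - B * y
    peel : ∀ z w a I x B y → z - w - (a + (+ 1 + I)) * (+ 1 + x) - B * y ≡ (z - w - (a + I) * (+ 1 + x) - B * y) - (+ 1 + x)
    peel = solve-∀
    shift : ∀ z w a I b J x y → z - (w + + 4 * x + + 6 * y + + 3) - (a + I) * (+ 1 + x) - (b + J) * y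
                              ≡ (z - (a + (+ 3 + I))) - w - (a + (+ 4 + I)) * x - (b + (+ 6 + J)) * y
    shift = solve-∀

  diagonal : ∀ m → Σdiag (λ n₁ n₂ → T A B n₁ n₂ z - T A′ B n₁ n₂ z) m
                 ≡ xq 1 (a + + (3 ℕ.+ i)) (S (a + + (4 ℕ.+ i)) (b + + (6 ℕ.+ j))) m z
  diagonal zero    = no-n₁ 0
  diagonal (suc m) = trans (Σdiag-suc _ no-n₁ m) (Σdiag-cong step m)

S-diff-b : ∀ a b i j m z →
  S (a + + i) (b + + j) m z - S (a + + i) (b + + (3 ℕ.+ j)) m z
    ≡ xq 2 (b + + (9 ℕ.+ j)) (S (a + + (6 ℕ.+ i)) (b + + (12 ℕ.+ j))) m z
S-diff-b a b i j m z = trans (sym (Σdiag-distrib-- _ _ m)) (diagonal m)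
  where
  A  = a + + i
  B  = b + + j
  B′ = b + + (3 ℕ.+ j)

  no-n₂ : ∀ n₁ → T A B n₁ 0 z - T A B′ n₁ 0 z ≡ + 0
  no-n₂ n₁ = trans (cong (λ t → T A B n₁ 0 z - ρ n₁ 0 t) (sym (drop-b z (Q (+ n₁) (+ 0)) A (+ n₁) B B′)))
                   (ℤP.+-inverseʳ (T A B n₁ 0 z))
    where
    drop-b : ∀ z w a x b b′ → z - w - a * x - b * + 0 ≡ z - w - a * x - b′ * + 0
    drop-b = solve-∀

  step : ∀ n₁ n₂ → T A B n₁ (suc n₂) z - T A B′ n₁ (suc n₂) z
                 ≡ T (a + + (6 ℕ.+ i)) (b + + (12 ℕ.+ j)) n₁ n₂ (z - (b + + (9 ℕ.+ j)))
  step n₁ n₂ = begin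
    ρ n₁ (suc n₂) Z - ρ n₁ (suc n₂) (z - Q x y′ - A * x - B′ * y′)
      ≡⟨ cong (λ t → ρ n₁ (suc n₂) Z - ρ n₁ (suc n₂) t)
              (trans (peel z (Q x y′) A x b (+ j) y) (cong (_-_ Z) (sym (ℤP.pos-* (suc n₂) 3)))) ⟩
    ρ n₁ (suc n₂) Z - ρ n₁ (suc n₂) (Z - + (suc n₂ ℕ.* 3))
      ≡⟨ ρ-suc₂ n₁ n₂ Z ⟨
    ρ n₁ n₂ Z
      ≡⟨ cong (ρ n₁ n₂) (trans (cong (λ w → z - w - A * x - B * y′) (Q-suc₂ x y)) (shift z (Q x y) a (+ i) b (+ j) x y)) ⟩
    T (a + + (6 ℕ.+ i)) (b + + (12 ℕ.+ j)) n₁ n₂ (z - (b + + (9 ℕ.+ j))) ∎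
    where
    x  = + n₁
    y  = + n₂
    y′ = + suc n₂
    Z  = z - Q x y′ - A * x - B * y′
    peel : ∀ z w A x b J y → z - w - A * x - (b + (+ 3 + J)) * (+ 1 + y) ≡ (z - w - A * x - (b + J) * (+ 1 + y)) - (+ 1 + y) * + 3
    peel = solve-∀
    shift : ∀ z w a I b J x y → z - (w + + 6 * x + + 12 * y + + 9) - (a + I) * x - (b + J) * (+ 1 + y)
                              ≡ (z - (b + (+ 9 + J))) - w - (a + (+ 6 + I)) * x - (b + (+ 12 + J)) * y
    shift = solve-∀

  diagonal : ∀ m → Σdiag (λ n₁ n₂ → T A B n₁ n₂ z - T A B′ n₁ n₂ z) m
                 ≡ xq 2 (b + + (9 ℕ.+ j)) (S (a + + (6 ℕ.+ i)) (b + + (12 ℕ.+ j))) m z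
  diagonal zero          = no-n₂ 0
  diagonal (suc zero)    = no-n₂ 1
  diagonal (suc (suc m)) =
    trans (cong (_+ Σdiag (λ n₁ n₂ → T A B n₁ (suc n₂) z - T A B′ n₁ (suc n₂) z) m) (no-n₂ (suc (suc m))))
          (trans (ℤP.+-identityˡ _) (Σdiag-cong step m))

x-y≡t⇒y+t≡x : ∀ {x y t} → x - y ≡ t → y + t ≡ x
x-y≡t⇒y+t≡x {x} {y} refl = solve (x ∷ y ∷ [])

split-diff : ∀ x y w → x - w ≡ (x - y) + (y - w)
split-diff = solve-∀

S-diff-b≡2a : ∀ a b → b ≡ + 2 * a → ∀ m z →
  S (a + + 0) (b + + 0) m z - S (a + + 1) (b + + 3) m z ≡ xq 1 (a + + 3) (S (a + + 3) (b + + 6)) m z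
S-diff-b≡2a a b b≡2a m z = begin
  S (a + + 0) (b + + 0) m z - S (a + + 1) (b + + 3) m z
    ≡⟨ split-diff (S (a + + 0) (b + + 0) m z) (S (a + + 1) (b + + 0) m z) (S (a + + 1) (b + + 3) m z) ⟩
  (S (a + + 0) (b + + 0) m z - S (a + + 1) (b + + 0) m z) + (S (a + + 1) (b + + 0) m z - S (a + + 1) (b + + 3) m z)
    ≡⟨ cong₂ _+_ (S-diff-a a b 0 0 m z) (S-diff-b a b 1 0 m z) ⟩
  xq 1 (a + + 3) (S (a + + 4) (b + + 6)) m z + xq 2 (b + + 9) (S (a + + 7) (b + + 12)) m z
    ≡⟨ merge m ⟩
  xq 1 (a + + 3) (S (a + + 3) (b + + 6)) m z ∎
  where
  merge : ∀ m → xq 1 (a + + 3) (S (a + + 4) (b + + 6)) m z + xq 2 (b + + 9) (S (a + + 7) (b + + 12)) m z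
              ≡ xq 1 (a + + 3) (S (a + + 3) (b + + 6)) m z
  merge zero    = refl
  merge (suc m) = begin
    S (a + + 4) (b + + 6) m z′ + xq 1 (b + + 9) (S (a + + 7) (b + + 12)) m z
      ≡⟨ cong (_+_ (S (a + + 4) (b + + 6) m z′)) (trans (xq-cong 1 exponent (λ _ _ → refl) m z)
                                                       (sym (xq-shift 1 (a + + 3) (a + + 6) _ m z))) ⟩
    S (a + + 4) (b + + 6) m z′ + xq 1 (a + + 6) (S (a + + 7) (b + + 12)) m z′
      ≡⟨ x-y≡t⇒y+t≡x (S-diff-a a b 3 6 m z′) ⟩
    S (a + + 3) (b + + 6) m z′ ∎
    where
    z′ = z - (a + + 3)
    exponent : b + + 9 ≡ (a + + 3) + (a + + 6)
    exponent = trans (cong (_+ + 9) b≡2a) (solve (a ∷ []))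

S-diff-b+1≡2a : ∀ a b → b + + 1 ≡ + 2 * a → ∀ m z →
  S (a + + 0) (b + + 0) m z - S (a + + 1) (b + + 3) m z
    ≡ xq 1 (a + + 3) (λ m z → S (a + + 4) (b + + 9) m z + S (a + + 2) (b + + 6) m z - S (a + + 3) (b + + 6) m z) m z
S-diff-b+1≡2a a b b+1≡2a m z = begin
  S (a + + 0) (b + + 0) m z - S (a + + 1) (b + + 3) m z
    ≡⟨ split-diff (S (a + + 0) (b + + 0) m z) (S (a + + 1) (b + + 0) m z) (S (a + + 1) (b + + 3) m z) ⟩
  (S (a + + 0) (b + + 0) m z - S (a + + 1) (b + + 0) m z) + (S (a + + 1) (b + + 0) m z - S (a + + 1) (b + + 3) m z)
    ≡⟨ cong₂ _+_ (S-diff-a a b 0 0 m z) (S-diff-b a b 1 0 m z) ⟩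
  xq 1 (a + + 3) (S (a + + 4) (b + + 6)) m z + xq 2 (b + + 9) (S (a + + 7) (b + + 12)) m z
    ≡⟨ merge m ⟩
  xq 1 (a + + 3) (λ m z → S (a + + 4) (b + + 9) m z + S (a + + 2) (b + + 6) m z - S (a + + 3) (b + + 6) m z) m z ∎
  where
  merge : ∀ m → xq 1 (a + + 3) (S (a + + 4) (b + + 6)) m z + xq 2 (b + + 9) (S (a + + 7) (b + + 12)) m z
              ≡ xq 1 (a + + 3) (λ m z → S (a + + 4) (b + + 9) m z + S (a + + 2) (b + + 6) m z - S (a + + 3) (b + + 6) m z) m z
  merge zero    = refl
  merge (suc m) = recombine {X} {Y} {S (a + + 4) (b + + 9) m z′} {S (a + + 2) (b + + 6) m z′} {S (a + + 3) (b + + 6) m z′}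
                            (S-diff-b a b 4 6 m z′) (trans (cong (_- Y) V-W) P-Y)
    where
    z′ = z - (a + + 3)
    X  = S (a + + 4) (b + + 6) m z′
    Y  = xq 1 (b + + 9) (S (a + + 7) (b + + 12)) m z
    S₁₀ = S (a + + 10) (b + + 18)
    exponent : (a + + 3) + (a + + 5) ≡ b + + 9
    exponent = begin
      (a + + 3) + (a + + 5)  ≡⟨ solve (a ∷ []) ⟩
      + 2 * a + + 8          ≡⟨ cong (_+ + 8) b+1≡2a ⟨
      (b + + 1) + + 8        ≡⟨ solve (b ∷ []) ⟩
      b + + 9                ∎
    V-W : S (a + + 2) (b + + 6) m z′ - S (a + + 3) (b + + 6) m z′ ≡ xq 1 (b + + 9) (S (a + + 6) (b + + 12)) m z
    V-W = trans (S-diff-a a b 2 6 m z′)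
                (trans (xq-shift 1 (a + + 3) (a + + 5) _ m z)
                       (xq-cong 1 exponent (λ _ _ → refl) m z))
    P-Y : xq 1 (b + + 9) (S (a + + 6) (b + + 12)) m z - Y ≡ xq 2 (b + + 15) S₁₀ m z′
    P-Y = begin
      xq 1 (b + + 9) (S (a + + 6) (b + + 12)) m z - Y
        ≡⟨ xq-distrib-- 1 (b + + 9) _ _ m z ⟩
      xq 1 (b + + 9) (λ m z → S (a + + 6) (b + + 12) m z - S (a + + 7) (b + + 12) m z) m z
        ≡⟨ xq-cong 1 refl (S-diff-a a b 6 12) m z ⟩
      xq 1 (b + + 9) (xq 1 (a + + 9) S₁₀) m z
        ≡⟨ xq-xq 1 1 (b + + 9) (a + + 9) S₁₀ m z ⟩
      xq 2 ((b + + 9) + (a + + 9)) S₁₀ m z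
        ≡⟨ xq-cong 2 {(b + + 9) + (a + + 9)} {(a + + 3) + (b + + 15)} (solve (a ∷ b ∷ [])) (λ _ _ → refl) m z ⟩
      xq 2 ((a + + 3) + (b + + 15)) S₁₀ m z
        ≡⟨ xq-shift 2 (a + + 3) (b + + 15) S₁₀ m z ⟨
      xq 2 (b + + 15) S₁₀ m z′ ∎
    recombine : ∀ {X Y U V W t} → X - U ≡ t → (V - W) - Y ≡ t → X + Y ≡ U + V - W
    recombine {X} {Y} {U} {V} {W} X-U≡t V-W-Y≡t = begin
      X + Y                  ≡⟨ solve (X ∷ Y ∷ U ∷ []) ⟩
      U + (X - U) + Y        ≡⟨ cong (λ s → U + s + Y) (trans X-U≡t (sym V-W-Y≡t)) ⟩
      U + ((V - W) - Y) + Y  ≡⟨ solve (Y ∷ U ∷ V ∷ W ∷ []) ⟩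
      U + V - W              ∎

ε : ℕ → ℤ
ε 0 = + 0
ε 1 = + 1
ε _ = -[1+ 0 ]

aG bG : ℕ → ℤ
aG k = + k - + 3
bG k = + 2 * aG k + ε (k % 3)

-- By `cpFrom-G`, G k is the generating function of the partitions counted by cp₂ with all parts at least k.
G : ℕ → Coeffs
G k = S (aG k) (bG k)

-- F k stands for the series of partitions with smallest part at least k: a part x can be followed by
-- x + 3 or any part ≥ x + 4 if x ≡ 0, by any part ≥ x + 4 if x ≡ 1, and by x + 2 or any part ≥ x + 4
-- if x ≡ 2 (mod 3).
successors : ℕ → ℕ → (ℕ → ℤ) → ℤ
successors 0 x F = F (3 ℕ.+ x)
successors 1 x F = F (4 ℕ.+ x)
successors _ x F = F (4 ℕ.+ x) + F (2 ℕ.+ x) - F (3 ℕ.+ x)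

Gnext : ℕ → Coeffs
Gnext x m z = successors (x % 3) x (λ k → G k m z)

residue : ∀ k → k % 3 ≡ 0 ⊎ k % 3 ≡ 1 ⊎ k % 3 ≡ 2
residue k with k % 3 | m%n<n k 3
... | 0                 | _ = inj₁ refl
... | 1                 | _ = inj₂ (inj₁ refl)
... | 2                 | _ = inj₂ (inj₂ refl)
... | suc (suc (suc _)) | s≤s (s≤s (s≤s ()))

residue-+ : ∀ c k → (c ℕ.+ k) % 3 ≡ (c ℕ.+ k % 3) % 3
residue-+ c k = begin
  (c ℕ.+ k) % 3                 ≡⟨ %-distribˡ-+ c k 3 ⟩
  (c % 3 ℕ.+ k % 3) % 3         ≡⟨ cong (λ t → (c % 3 ℕ.+ t) % 3) (m%n%n≡m%n k 3) ⟨
  (c % 3 ℕ.+ k % 3 % 3) % 3     ≡⟨ %-distribˡ-+ c (k % 3) 3 ⟨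
  (c ℕ.+ k % 3) % 3             ∎

-- Once c and the residue r are literals, the hypothesis on j is a closed computation, proved by refl.
G-shift : ∀ k c j {r} → k % 3 ≡ r → + 2 * + c + ε ((c ℕ.+ r) % 3) ≡ + j + ε r →
          ∀ m z → G (c ℕ.+ k) m z ≡ S (aG k + + c) (bG k + + j) m z
G-shift k c j {r} k≡r jump m z = cong₂ (λ a b → S a b m z) a-shift b-shift
  where
  a-shift : aG (c ℕ.+ k) ≡ aG k + + c
  a-shift = reorder (+ c) (+ k)
    where
    reorder : ∀ C K → C + K - + 3 ≡ K - + 3 + C
    reorder = solve-∀
  regroup : ∀ A C E → + 2 * (A + C) + E ≡ + 2 * A + (+ 2 * C + E)
  regroup = solve-∀
  regroup′ : ∀ A J E → A + (J + E) ≡ A + E + J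
  regroup′ = solve-∀
  b-shift : bG (c ℕ.+ k) ≡ bG k + + j
  b-shift = begin
    + 2 * aG (c ℕ.+ k) + ε ((c ℕ.+ k) % 3)
      ≡⟨ cong₂ (λ a r′ → + 2 * a + ε r′) a-shift (trans (residue-+ c k) (cong (λ r′ → (c ℕ.+ r′) % 3) k≡r)) ⟩
    + 2 * (aG k + + c) + ε ((c ℕ.+ r) % 3)         ≡⟨ regroup (aG k) (+ c) _ ⟩
    + 2 * aG k + (+ 2 * + c + ε ((c ℕ.+ r) % 3))   ≡⟨ cong (_+_ (+ 2 * aG k)) jump ⟩
    + 2 * aG k + (+ j + ε r)                       ≡⟨ regroup′ (+ 2 * aG k) (+ j) (ε r) ⟩
    + 2 * aG k + ε r + + j                         ≡⟨ cong (λ r′ → + 2 * aG k + ε r′ + + j) k≡r ⟨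
    bG k + + j                                     ∎

Gnext-residue : ∀ k {r} → k % 3 ≡ r → ∀ m z → Gnext k m z ≡ successors r k (λ j → G j m z)
Gnext-residue k k≡r m z = cong (λ r → successors r k (λ j → G j m z)) k≡r

aG+3 : ∀ k → aG k + + 3 ≡ + k
aG+3 k = cancel (+ k)
  where
  cancel : ∀ K → K - + 3 + + 3 ≡ K
  cancel = solve-∀

G-diff : ∀ k m z → G k m z - G (suc k) m z ≡ xq 1 (+ k) (Gnext k) m z
G-diff k m z with residue k
... | inj₁ k≡0 = begin
  G k m z - G (suc k) m z
    ≡⟨ cong₂ _-_ (G-shift k 0 0 k≡0 refl m z) (G-shift k 1 3 k≡0 refl m z) ⟩
  S (aG k + + 0) (bG k + + 0) m z - S (aG k + + 1) (bG k + + 3) m z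
    ≡⟨ S-diff-b≡2a (aG k) (bG k) (trans (cong (λ r → + 2 * aG k + ε r) k≡0) (ℤP.+-identityʳ _)) m z ⟩
  xq 1 (aG k + + 3) (S (aG k + + 3) (bG k + + 6)) m z
    ≡⟨ xq-cong 1 {F = S (aG k + + 3) (bG k + + 6)} (aG+3 k) (λ m z → sym (trans (Gnext-residue k k≡0 m z) (G-shift k 3 6 k≡0 refl m z))) m z ⟩
  xq 1 (+ k) (Gnext k) m z ∎
... | inj₂ (inj₁ k≡1) = begin
  G k m z - G (suc k) m z
    ≡⟨ cong₂ _-_ (G-shift k 0 0 k≡1 refl m z) (G-shift k 1 0 k≡1 refl m z) ⟩
  S (aG k + + 0) (bG k + + 0) m z - S (aG k + + 1) (bG k + + 0) m z
    ≡⟨ S-diff-a (aG k) (bG k) 0 0 m z ⟩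
  xq 1 (aG k + + 3) (S (aG k + + 4) (bG k + + 6)) m z
    ≡⟨ xq-cong 1 {F = S (aG k + + 4) (bG k + + 6)} (aG+3 k) (λ m z → sym (trans (Gnext-residue k k≡1 m z) (G-shift k 4 6 k≡1 refl m z))) m z ⟩
  xq 1 (+ k) (Gnext k) m z ∎
... | inj₂ (inj₂ k≡2) = begin
  G k m z - G (suc k) m z
    ≡⟨ cong₂ _-_ (G-shift k 0 0 k≡2 refl m z) (G-shift k 1 3 k≡2 refl m z) ⟩
  S (aG k + + 0) (bG k + + 0) m z - S (aG k + + 1) (bG k + + 3) m z
    ≡⟨ S-diff-b+1≡2a (aG k) (bG k) (trans (cong (λ r → + 2 * aG k + ε r + + 1) k≡2) (cancel (+ 2 * aG k))) m z ⟩
  xq 1 (aG k + + 3) (λ m z → S (aG k + + 4) (bG k + + 9) m z + S (aG k + + 2) (bG k + + 6) m z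
                               - S (aG k + + 3) (bG k + + 6) m z) m z
    ≡⟨ xq-cong 1 {F′ = Gnext k} (aG+3 k) (λ m z → sym (trans (Gnext-residue k k≡2 m z)
         (cong₂ _-_ (cong₂ _+_ (G-shift k 4 9 k≡2 refl m z) (G-shift k 2 6 k≡2 refl m z))
                    (G-shift k 3 6 k≡2 refl m z)))) m z ⟩
  xq 1 (+ k) (Gnext k) m z ∎
  where
  cancel : ∀ A → A - + 1 + + 1 ≡ A
  cancel = solve-∀

-- Counting partitions

Σ₁ : ℕ → (ℕ → ℕ) → ℕ
Σ₁ zero    h = 0
Σ₁ (suc N) h = Σ₁ N h ℕ.+ h (suc N)

Σ₁-cong : ∀ N {f g : ℕ → ℕ} → (∀ y → 1 ℕ.≤ y → y ℕ.≤ N → f y ≡ g y) → Σ₁ N f ≡ Σ₁ N g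
Σ₁-cong zero    eq = refl
Σ₁-cong (suc N) eq = cong₂ ℕ._+_ (Σ₁-cong N (λ y 1≤y y≤N → eq y 1≤y (ℕP.m≤n⇒m≤1+n y≤N))) (eq (suc N) (s≤s z≤n) ℕP.≤-refl)

Σ₁-zero : ∀ N {f : ℕ → ℕ} → (∀ y → 1 ℕ.≤ y → y ℕ.≤ N → f y ≡ 0) → Σ₁ N f ≡ 0
Σ₁-zero zero    eq = refl
Σ₁-zero (suc N) eq = cong₂ ℕ._+_ (Σ₁-zero N (λ y 1≤y y≤N → eq y 1≤y (ℕP.m≤n⇒m≤1+n y≤N))) (eq (suc N) (s≤s z≤n) ℕP.≤-refl)

Σ₁-distrib-+ : ∀ N (f g : ℕ → ℕ) → Σ₁ N (λ y → f y ℕ.+ g y) ≡ Σ₁ N f ℕ.+ Σ₁ N g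
Σ₁-distrib-+ zero    f g = refl
Σ₁-distrib-+ (suc N) f g =
  trans (cong (ℕ._+ (f (suc N) ℕ.+ g (suc N))) (Σ₁-distrib-+ N f g))
        (middle-swap (Σ₁ N f) (Σ₁ N g) (f (suc N)) (g (suc N)))
  where
  middle-swap : ∀ a b c d → (a ℕ.+ b) ℕ.+ (c ℕ.+ d) ≡ (a ℕ.+ c) ℕ.+ (b ℕ.+ d)
  middle-swap = ℕ-Solver.solve-∀

Σ₁-single : ∀ N c {f : ℕ → ℕ} → 1 ℕ.≤ c → c ℕ.≤ N → (∀ y → 1 ℕ.≤ y → y ℕ.≤ N → y ≢ c → f y ≡ 0) → Σ₁ N f ≡ f c
Σ₁-single zero    c ()    z≤n others
Σ₁-single (suc N) c {f} 1≤c c≤1+N others with c ℕ.≤? N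
... | yes c≤N =
  trans (cong₂ ℕ._+_ (Σ₁-single N c 1≤c c≤N (λ y 1≤y y≤N → others y 1≤y (ℕP.m≤n⇒m≤1+n y≤N)))
                     (others (suc N) (s≤s z≤n) ℕP.≤-refl (λ { refl → ℕP.1+n≰n c≤N })))
        (ℕP.+-identityʳ (f c))
... | no c≰N with refl ← ℕP.≤-antisym c≤1+N (ℕP.≰⇒> c≰N) =
  cong (ℕ._+ f (suc N)) (Σ₁-zero N (λ y 1≤y y≤N → others y 1≤y (ℕP.m≤n⇒m≤1+n y≤N) (λ { refl → ℕP.1+n≰n y≤N })))

sum-upTo : ∀ N h → sum (map h (map suc (upTo N))) ≡ Σ₁ N h
sum-upTo zero    h = refl
sum-upTo (suc N) h = begin
  sum (map h (map suc (upTo (suc N))))        ≡⟨ cong (λ l → sum (map h (map suc l))) (LP.upTo-∷ʳ N) ⟨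
  sum (map h (map suc (upTo N ∷ʳ N)))         ≡⟨ cong (λ l → sum (map h l)) (LP.map-++ suc (upTo N) [ N ]) ⟩
  sum (map h (map suc (upTo N) ∷ʳ suc N))     ≡⟨ cong sum (LP.map-++ h (map suc (upTo N)) [ suc N ]) ⟩
  sum (map h (map suc (upTo N)) ∷ʳ h (suc N)) ≡⟨ sum-++ (map h (map suc (upTo N))) [ h (suc N) ] ⟩
  sum (map h (map suc (upTo N))) ℕ.+ (h (suc N) ℕ.+ 0)
    ≡⟨ cong₂ ℕ._+_ (sum-upTo N h) (ℕP.+-identityʳ (h (suc N))) ⟩
  Σ₁ N h ℕ.+ h (suc N)                        ∎

length-filter-concatMap : ∀ {P : List ℕ → Set} (P? : Decidable P) (f : ℕ → List (List ℕ)) xs →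
  length (filter P? (concatMap f xs)) ≡ sum (map (λ x → length (filter P? (f x))) xs)
length-filter-concatMap P? f []       = refl
length-filter-concatMap P? f (x ∷ xs) = begin
  length (filter P? (f x ++ concatMap f xs))                    ≡⟨ cong length (LP.filter-++ P? (f x) _) ⟩
  length (filter P? (f x) ++ filter P? (concatMap f xs))        ≡⟨ LP.length-++ (filter P? (f x)) ⟩
  length (filter P? (f x)) ℕ.+ length (filter P? (concatMap f xs))
    ≡⟨ cong (length (filter P? (f x)) ℕ.+_) (length-filter-concatMap P? f xs) ⟩
  length (filter P? (f x)) ℕ.+ sum (map (λ x → length (filter P? (f x))) xs) ∎

length-filter-cons : ∀ {P Q : List ℕ → Set} {C : Set} (P? : Decidable P) (Q? : Decidable Q) (C? : Dec C) y →
  (∀ ys → P (y ∷ ys) ⇔ (C × Q ys)) →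
  ∀ L → length (filter P? (map (y ∷_) L)) ≡ (if does C? then length (filter Q? L) else 0)
length-filter-cons P? Q? (yes c) y split = go
  where
  go : ∀ L → length (filter P? (map (y ∷_) L)) ≡ length (filter Q? L)
  go []       = refl
  go (ys ∷ L) with P? (y ∷ ys) | Q? ys
  ... | yes _  | yes _  = cong suc (go L)
  ... | no _   | no _   = go L
  ... | yes p  | no ¬q  = contradiction (proj₂ (Equivalence.to (split ys) p)) ¬q
  ... | no ¬p  | yes q  = contradiction (Equivalence.from (split ys) (c , q)) ¬p
length-filter-cons P? Q? (no ¬c) y split = go
  where
  go : ∀ L → length (filter P? (map (y ∷_) L)) ≡ 0
  go []       = refl
  go (ys ∷ L) with P? (y ∷ ys)
  ... | yes p = contradiction (proj₁ (Equivalence.to (split ys) p)) ¬c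
  ... | no _  = go L

length-filter-lists : ∀ {P : List ℕ → Set} (P? : Decidable P) N m →
  length (filter P? (lists N (suc m))) ≡ Σ₁ N (λ y → length (filter P? (map (y ∷_) (lists N m))))
length-filter-lists P? N m =
  trans (length-filter-concatMap P? (λ y → map (y ∷_) (lists N m)) (map suc (upTo N)))
        (sum-upTo N (λ y → length (filter P? (map (y ∷_) (lists N m)))))

Follows : ℕ → ℕ → List ℕ → Set
Follows x n xs = (sum xs ≡ n) × (All (λ y → y ≢ 2) xs × Linked Gap (x ∷ xs))

follows? : ∀ x n → Decidable (Follows x n)
follows? x n xs = (sum xs ℕ.≟ n) ×-dec (All.all? (λ y → ¬? (y ℕ.≟ 2)) xs ×-dec Linked.linked? gap? (x ∷ xs))

after : ℕ → ℕ → ℕ → ℕ → ℕ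
after N x m n = length (filter (follows? x n) (lists N m))

startingWith : ℕ → ℕ → ℕ → ℕ → ℕ
startingWith N y m n = if does (y ℕ.≤? n) then after N y m (n ℕ.∸ y) else 0

sum-cons : ∀ y ys n → (y ℕ.+ sum ys ≡ n) ⇔ (y ℕ.≤ n × sum ys ≡ n ℕ.∸ y)
sum-cons y ys n = mk⇔ to from
  where
  to : y ℕ.+ sum ys ≡ n → y ℕ.≤ n × sum ys ≡ n ℕ.∸ y
  to refl = ℕP.m≤m+n y (sum ys) , sym (ℕP.m+n∸m≡n y (sum ys))
  from : y ℕ.≤ n × sum ys ≡ n ℕ.∸ y → y ℕ.+ sum ys ≡ n
  from (y≤n , eq) = trans (cong (y ℕ.+_) eq) (ℕP.m+[n∸m]≡n y≤n)

follows-cons : ∀ x n y ys → Follows x n (y ∷ ys) ⇔ ((Gap x y × (y ≢ 2 × y ℕ.≤ n)) × Follows y (n ℕ.∸ y) ys)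
follows-cons x n y ys = mk⇔ to from
  where
  to : Follows x n (y ∷ ys) → (Gap x y × (y ≢ 2 × y ℕ.≤ n)) × Follows y (n ℕ.∸ y) ys
  to (sum≡n , (y≢2 ∷ᴬ ys≢2) , (gap ∷ᴸ linked)) with Equivalence.to (sum-cons y ys n) sum≡n
  ... | y≤n , rest = (gap , y≢2 , y≤n) , rest , ys≢2 , linked
  from : (Gap x y × (y ≢ 2 × y ℕ.≤ n)) × Follows y (n ℕ.∸ y) ys → Follows x n (y ∷ ys)
  from ((gap , y≢2 , y≤n) , rest , ys≢2 , linked) =
    Equivalence.from (sum-cons y ys n) (y≤n , rest) , (y≢2 ∷ᴬ ys≢2) , (gap ∷ᴸ linked)

valid-cons : ∀ n y ys → ValidCP2 n (y ∷ ys) ⇔ ((y ≢ 2 × y ℕ.≤ n) × Follows y (n ℕ.∸ y) ys)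
valid-cons n y ys = mk⇔ to from
  where
  to : ValidCP2 n (y ∷ ys) → (y ≢ 2 × y ℕ.≤ n) × Follows y (n ℕ.∸ y) ys
  to (sum≡n , (y≢2 ∷ᴬ ys≢2) , linked) with Equivalence.to (sum-cons y ys n) sum≡n
  ... | y≤n , rest = (y≢2 , y≤n) , rest , ys≢2 , linked
  from : (y ≢ 2 × y ℕ.≤ n) × Follows y (n ℕ.∸ y) ys → ValidCP2 n (y ∷ ys)
  from ((y≢2 , y≤n) , rest , ys≢2 , linked) = Equivalence.from (sum-cons y ys n) (y≤n , rest) , (y≢2 ∷ᴬ ys≢2) , linked

after-zero : ∀ N x n → after N x 0 n ≡ (if does (n ℕ.≟ 0) then 1 else 0)
after-zero N x n with n ℕ.≟ 0
... | yes refl = cong length (LP.filter-accept (follows? x 0) {[]} {[]} (refl , []ᴬ , [-]))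
... | no n≢0   = trans (cong length (LP.filter-reject (follows? x n) {[]} {[]} (λ (sum≡n , _) → n≢0 (sym sum≡n))))
                        (sym (if-no (n ℕ.≟ 0) n≢0))

cp₂-zero : ∀ n → cp₂ n 0 ≡ (if does (n ℕ.≟ 0) then 1 else 0)
cp₂-zero n with n ℕ.≟ 0
... | yes refl = cong length (LP.filter-accept (validCP2? 0) {[]} {[]} (refl , []ᴬ , []ᴸ))
... | no n≢0   = trans (cong length (LP.filter-reject (validCP2? n) {[]} {[]} (λ (sum≡n , _) → n≢0 (sym sum≡n))))
                        (sym (if-no (n ℕ.≟ 0) n≢0))

ΣFirst : ℕ → ℕ → ℕ → {P : ℕ → Set} → Decidable P → ℕ
ΣFirst N m n P? = Σ₁ N (λ y → if does (P? y) then startingWith N y m n else 0)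

after-suc : ∀ N x m n → 1 ℕ.≤ x → after N x (suc m) n ≡ ΣFirst N m n (gap? x)
after-suc N x m n 1≤x =
  trans (length-filter-lists (follows? x n) N m) (Σ₁-cong N (λ y _ _ → trans
    (length-filter-cons (follows? x n) (follows? y (n ℕ.∸ y)) (step? y) y (follows-cons x n y) (lists N m))
    (first-step y)))
  where
  step? : ∀ y → Dec (Gap x y × (y ≢ 2 × y ℕ.≤ n))
  step? y = gap? x y ×-dec (¬? (y ℕ.≟ 2) ×-dec (y ℕ.≤? n))
  first-step : ∀ y → (if does (step? y) then after N y m (n ℕ.∸ y) else 0)
                   ≡ (if does (gap? x y) then startingWith N y m n else 0)
  first-step y = by-cases (gap? x y) (¬? (y ℕ.≟ 2))
    where
    by-cases : (g : Dec (Gap x y)) (y≢2? : Dec (y ≢ 2)) →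
               (if does g ∧ (does y≢2? ∧ does (y ℕ.≤? n)) then after N y m (n ℕ.∸ y) else 0)
               ≡ (if does g then startingWith N y m n else 0)
    by-cases (no _)                _       = refl
    by-cases (yes _)               (yes _) = refl
    by-cases (yes (x+2≤y , _))     (no y≡2) =
      contradiction (λ { refl → ℕP.<⇒≱ (ℕP.+-monoˡ-≤ 2 1≤x) x+2≤y }) y≡2

cp₂-suc : ∀ n m → cp₂ n (suc m) ≡ ΣFirst n m n (λ y → ¬? (y ℕ.≟ 2))
cp₂-suc n m =
  trans (length-filter-lists (validCP2? n) n m) (Σ₁-cong n (λ y _ _ → trans
    (length-filter-cons (validCP2? n) (follows? y (n ℕ.∸ y)) (¬? (y ℕ.≟ 2) ×-dec (y ℕ.≤? n)) y (valid-cons n y) (lists n m))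
    (first-step y)))
  where
  first-step : ∀ y → (if does (¬? (y ℕ.≟ 2) ×-dec (y ℕ.≤? n)) then after n y m (n ℕ.∸ y) else 0)
                   ≡ (if does (¬? (y ℕ.≟ 2)) then startingWith n y m n else 0)
  first-step y = by-cases (¬? (y ℕ.≟ 2))
    where
    by-cases : (y≢2? : Dec (y ≢ 2)) → (if does y≢2? ∧ does (y ℕ.≤? n) then after n y m (n ℕ.∸ y) else 0)
                                    ≡ (if does y≢2? then startingWith n y m n else 0)
    by-cases (yes _) = refl
    by-cases (no _)  = refl

startingWith-above : ∀ N y m n → n ℕ.< y → startingWith N y m n ≡ 0
startingWith-above N y m n n<y = if-no (y ℕ.≤? n) (ℕP.<⇒≱ n<y)

ΣFirst-cong : ∀ N m n {P P′ : ℕ → Set} (P? : Decidable P) (P′? : Decidable P′) →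
              (∀ y → 1 ℕ.≤ y → P y ⇔ P′ y) → ΣFirst N m n P? ≡ ΣFirst N m n P′?
ΣFirst-cong N m n P? P′? P⇔P′ =
  Σ₁-cong N (λ y 1≤y _ → cong (λ b → if b then startingWith N y m n else 0) (does-⇔ (P⇔P′ y 1≤y) (P? y) (P′? y)))

ΣFirst-⊎ : ∀ N m n {P P′ : ℕ → Set} (P? : Decidable P) (P′? : Decidable P′) → (∀ y → P y → ¬ P′ y) →
           ΣFirst N m n (λ y → P? y ⊎-dec P′? y) ≡ ΣFirst N m n P? ℕ.+ ΣFirst N m n P′?
ΣFirst-⊎ N m n {P} {P′} P? P′? disjoint = trans (Σ₁-cong N (λ y _ _ → by-cases y (P? y) (P′? y))) (Σ₁-distrib-+ N _ _)
  where
  by-cases : ∀ y (p : Dec (P y)) (p′ : Dec (P′ y)) →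
             (if does p ∨ does p′ then startingWith N y m n else 0)
             ≡ (if does p then startingWith N y m n else 0) ℕ.+ (if does p′ then startingWith N y m n else 0)
  by-cases y (yes p) (yes p′) = contradiction p′ (disjoint y p)
  by-cases y (yes _) (no _)   = sym (ℕP.+-identityʳ _)
  by-cases y (no _)  _        = refl

ΣFirst-≡ : ∀ N m n c → 1 ℕ.≤ c → n ℕ.≤ N → ΣFirst N m n (ℕ._≟ c) ≡ startingWith N c m n
ΣFirst-≡ N m n c 1≤c n≤N with c ℕ.≤? N
... | yes c≤N = trans (Σ₁-single N c 1≤c c≤N (λ y _ _ y≢c → if-no (y ℕ.≟ c) y≢c)) (if-yes (c ℕ.≟ c) refl)
... | no c≰N  = trans (Σ₁-zero N (λ y _ y≤N → if-no (y ℕ.≟ c) (λ { refl → c≰N y≤N })))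
                      (sym (startingWith-above N c m n (ℕP.≤-<-trans n≤N (ℕP.≰⇒> c≰N))))

ΣFirst-≥-empty : ∀ N m n k → n ℕ.< k → ΣFirst N m n (k ℕ.≤?_) ≡ 0
ΣFirst-≥-empty N m n k n<k = Σ₁-zero N (λ y _ _ → by-cases y (k ℕ.≤? y))
  where
  by-cases : ∀ y (k≤?y : Dec (k ℕ.≤ y)) → (if does k≤?y then startingWith N y m n else 0) ≡ 0
  by-cases y (yes k≤y) = startingWith-above N y m n (ℕP.<-≤-trans n<k k≤y)
  by-cases y (no _)    = refl

ΣFirst-≥-suc : ∀ N m n k → 1 ℕ.≤ k → n ℕ.≤ N →
               ΣFirst N m n (k ℕ.≤?_) ≡ startingWith N k m n ℕ.+ ΣFirst N m n (suc k ℕ.≤?_)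
ΣFirst-≥-suc N m n k 1≤k n≤N = begin
  ΣFirst N m n (k ℕ.≤?_)
    ≡⟨ ΣFirst-cong N m n (k ℕ.≤?_) (λ y → (y ℕ.≟ k) ⊎-dec (suc k ℕ.≤? y)) (λ y _ → mk⇔ to from) ⟩
  ΣFirst N m n (λ y → (y ℕ.≟ k) ⊎-dec (suc k ℕ.≤? y))
    ≡⟨ ΣFirst-⊎ N m n (ℕ._≟ k) (suc k ℕ.≤?_) (λ { y refl → ℕP.n≮n y }) ⟩
  ΣFirst N m n (ℕ._≟ k) ℕ.+ ΣFirst N m n (suc k ℕ.≤?_)
    ≡⟨ cong (ℕ._+ ΣFirst N m n (suc k ℕ.≤?_)) (ΣFirst-≡ N m n k 1≤k n≤N) ⟩
  startingWith N k m n ℕ.+ ΣFirst N m n (suc k ℕ.≤?_) ∎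
  where
  to : ∀ {y} → k ℕ.≤ y → y ≡ k ⊎ suc k ℕ.≤ y
  to k≤y with ℕP.m≤n⇒m<n∨m≡n k≤y
  ... | inj₁ k<y  = inj₂ k<y
  ... | inj₂ refl = inj₁ refl
  from : ∀ {y} → y ≡ k ⊎ suc k ℕ.≤ y → k ℕ.≤ y
  from (inj₁ refl) = ℕP.≤-refl
  from (inj₂ k<y)  = ℕP.<⇒≤ k<y

-- The cp₂-partitions of n into m parts ≤ N, all of them at least k.
cpFrom : ℕ → ℕ → ℕ → ℕ → ℕ
cpFrom N k zero    n = if does (n ℕ.≟ 0) then 1 else 0
cpFrom N k (suc m) n = ΣFirst N m n (k ℕ.≤?_)

gap-position : ∀ x y → x ℕ.+ 2 ℕ.≤ y → y ≡ 2 ℕ.+ x ⊎ y ≡ 3 ℕ.+ x ⊎ 4 ℕ.+ x ℕ.≤ y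
gap-position x y x+2≤y with ℕP.m≤n⇒m<n∨m≡n (subst (ℕ._≤ y) (ℕP.+-comm x 2) x+2≤y)
... | inj₂ refl = inj₁ refl
... | inj₁ 3+x≤y with ℕP.m≤n⇒m<n∨m≡n 3+x≤y
...   | inj₂ refl  = inj₂ (inj₁ refl)
...   | inj₁ 4+x≤y = inj₂ (inj₂ 4+x≤y)

residue-x+[c+x] : ∀ c x {r} → x % 3 ≡ r → (x ℕ.+ (c ℕ.+ x)) % 3 ≡ (r ℕ.+ (c ℕ.+ r) % 3) % 3
residue-x+[c+x] c x refl = trans (%-distribˡ-+ x (c ℕ.+ x) 3) (cong (λ t → (x % 3 ℕ.+ t) % 3) (residue-+ c x))

%3≡1+k⇒3∤ : ∀ {t k} → t % 3 ≡ suc k → ¬ 3 ∣ t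
%3≡1+k⇒3∤ {t} t%3≡1+k 3∣t = ℕP.0≢1+n (trans (sym (n∣m⇒m%n≡0 t 3 3∣t)) t%3≡1+k)

+-comm-≤ : ∀ c x y → c ℕ.+ x ℕ.≤ y → x ℕ.+ c ℕ.≤ y
+-comm-≤ c x y = subst (ℕ._≤ y) (ℕP.+-comm c x)

gap-≡0 : ∀ {x y} → x % 3 ≡ 0 → Gap x y ⇔ 3 ℕ.+ x ℕ.≤ y
gap-≡0 {x} {y} x≡0 = mk⇔ to from
  where
  to : Gap x y → 3 ℕ.+ x ℕ.≤ y
  to (x+2≤y , inj₂ x+4≤y) = ℕP.<⇒≤ (+-comm-≤ x 4 y x+4≤y)
  to (x+2≤y , inj₁ 3∣x+y) with gap-position x y x+2≤y
  ... | inj₁ refl         = contradiction 3∣x+y (%3≡1+k⇒3∤ (residue-x+[c+x] 2 x x≡0))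
  ... | inj₂ (inj₁ refl)  = ℕP.≤-refl
  ... | inj₂ (inj₂ 4+x≤y) = ℕP.<⇒≤ 4+x≤y
  from : 3 ℕ.+ x ℕ.≤ y → Gap x y
  from 3+x≤y with ℕP.m≤n⇒m<n∨m≡n 3+x≤y
  ... | inj₂ refl  = +-comm-≤ 2 x y (ℕP.n≤1+n _) , inj₁ (m%n≡0⇒n∣m _ 3 (residue-x+[c+x] 3 x x≡0))
  ... | inj₁ 4+x≤y = +-comm-≤ 2 x y (ℕP.<⇒≤ 3+x≤y) , inj₂ (+-comm-≤ 4 x y 4+x≤y)

gap-≡1 : ∀ {x y} → x % 3 ≡ 1 → Gap x y ⇔ 4 ℕ.+ x ℕ.≤ y
gap-≡1 {x} {y} x≡1 = mk⇔ to from
  where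
  to : Gap x y → 4 ℕ.+ x ℕ.≤ y
  to (x+2≤y , inj₂ x+4≤y) = +-comm-≤ x 4 y x+4≤y
  to (x+2≤y , inj₁ 3∣x+y) with gap-position x y x+2≤y
  ... | inj₁ refl         = contradiction 3∣x+y (%3≡1+k⇒3∤ (residue-x+[c+x] 2 x x≡1))
  ... | inj₂ (inj₁ refl)  = contradiction 3∣x+y (%3≡1+k⇒3∤ (residue-x+[c+x] 3 x x≡1))
  ... | inj₂ (inj₂ 4+x≤y) = 4+x≤y
  from : 4 ℕ.+ x ℕ.≤ y → Gap x y
  from 4+x≤y = +-comm-≤ 2 x y (ℕP.<⇒≤ (ℕP.<⇒≤ 4+x≤y)) , inj₂ (+-comm-≤ 4 x y 4+x≤y)

gap-≡2 : ∀ {x y} → x % 3 ≡ 2 → Gap x y ⇔ (y ≡ 2 ℕ.+ x ⊎ 4 ℕ.+ x ℕ.≤ y)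
gap-≡2 {x} {y} x≡2 = mk⇔ to from
  where
  to : Gap x y → y ≡ 2 ℕ.+ x ⊎ 4 ℕ.+ x ℕ.≤ y
  to (x+2≤y , inj₂ x+4≤y) = inj₂ (+-comm-≤ x 4 y x+4≤y)
  to (x+2≤y , inj₁ 3∣x+y) with gap-position x y x+2≤y
  ... | inj₁ refl         = inj₁ refl
  ... | inj₂ (inj₁ refl)  = contradiction 3∣x+y (%3≡1+k⇒3∤ (residue-x+[c+x] 3 x x≡2))
  ... | inj₂ (inj₂ 4+x≤y) = inj₂ 4+x≤y
  from : y ≡ 2 ℕ.+ x ⊎ 4 ℕ.+ x ℕ.≤ y → Gap x y
  from (inj₁ refl)  = +-comm-≤ 2 x y ℕP.≤-refl , inj₁ (m%n≡0⇒n∣m _ 3 (residue-x+[c+x] 2 x x≡2))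
  from (inj₂ 4+x≤y) = +-comm-≤ 2 x y (ℕP.<⇒≤ (ℕP.<⇒≤ 4+x≤y)) , inj₂ (+-comm-≤ 4 x y 4+x≤y)

successors-const : ∀ r x (c : ℤ) → successors r x (λ _ → c) ≡ c
successors-const 0             x c = refl
successors-const 1             x c = refl
successors-const (suc (suc r)) x c = cancel c
  where
  cancel : ∀ c → c + c - c ≡ c
  cancel = solve-∀

successors-cong : ∀ r x {F F′ : ℕ → ℤ} → (∀ k → 2 ℕ.+ x ℕ.≤ k → F k ≡ F′ k) → successors r x F ≡ successors r x F′
successors-cong 0             x eq = eq (3 ℕ.+ x) (ℕP.n≤1+n _)
successors-cong 1             x eq = eq (4 ℕ.+ x) (ℕP.+-monoˡ-≤ x (s≤s (s≤s z≤n)))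
successors-cong (suc (suc r)) x eq =
  cong₂ _-_ (cong₂ _+_ (eq (4 ℕ.+ x) (ℕP.+-monoˡ-≤ x (s≤s (s≤s z≤n)))) (eq (2 ℕ.+ x) ℕP.≤-refl))
            (eq (3 ℕ.+ x) (ℕP.n≤1+n _))

after-≡0 : ∀ N x m n → x % 3 ≡ 0 → 1 ℕ.≤ x → after N x (suc m) n ≡ cpFrom N (3 ℕ.+ x) (suc m) n
after-≡0 N x m n x≡0 1≤x =
  trans (after-suc N x m n 1≤x) (ΣFirst-cong N m n (gap? x) ((3 ℕ.+ x) ℕ.≤?_) (λ _ _ → gap-≡0 x≡0))

after-≡1 : ∀ N x m n → x % 3 ≡ 1 → 1 ℕ.≤ x → after N x (suc m) n ≡ cpFrom N (4 ℕ.+ x) (suc m) n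
after-≡1 N x m n x≡1 1≤x =
  trans (after-suc N x m n 1≤x) (ΣFirst-cong N m n (gap? x) ((4 ℕ.+ x) ℕ.≤?_) (λ _ _ → gap-≡1 x≡1))

after-≡2 : ∀ N x m n → x % 3 ≡ 2 → 1 ℕ.≤ x → n ℕ.≤ N →
           after N x (suc m) n ≡ startingWith N (2 ℕ.+ x) m n ℕ.+ cpFrom N (4 ℕ.+ x) (suc m) n
after-≡2 N x m n x≡2 1≤x n≤N = begin
  after N x (suc m) n
    ≡⟨ after-suc N x m n 1≤x ⟩
  ΣFirst N m n (gap? x)
    ≡⟨ ΣFirst-cong N m n (gap? x) (λ y → (y ℕ.≟ 2 ℕ.+ x) ⊎-dec ((4 ℕ.+ x) ℕ.≤? y)) (λ _ _ → gap-≡2 x≡2) ⟩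
  ΣFirst N m n (λ y → (y ℕ.≟ 2 ℕ.+ x) ⊎-dec ((4 ℕ.+ x) ℕ.≤? y))
    ≡⟨ ΣFirst-⊎ N m n (ℕ._≟ 2 ℕ.+ x) ((4 ℕ.+ x) ℕ.≤?_) (λ { y refl 4+x≤2+x → ℕP.n≮n (2 ℕ.+ x) (ℕP.<⇒≤ 4+x≤2+x) }) ⟩
  ΣFirst N m n (ℕ._≟ 2 ℕ.+ x) ℕ.+ cpFrom N (4 ℕ.+ x) (suc m) n
    ≡⟨ cong (ℕ._+ cpFrom N (4 ℕ.+ x) (suc m) n) (ΣFirst-≡ N m n (2 ℕ.+ x) (s≤s z≤n) n≤N) ⟩
  startingWith N (2 ℕ.+ x) m n ℕ.+ cpFrom N (4 ℕ.+ x) (suc m) n ∎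

after-successors : ∀ N x m n → 1 ℕ.≤ x → n ℕ.≤ N → + after N x m n ≡ successors (x % 3) x (λ k → + cpFrom N k m n)
after-successors N x zero    n _   _   = trans (cong +_ (after-zero N x n)) (sym (successors-const (x % 3) x _))
after-successors N x (suc m) n 1≤x n≤N with residue x
... | inj₁ x≡0 =
  trans (cong +_ (after-≡0 N x m n x≡0 1≤x)) (cong (λ r → successors r x (λ k → + cpFrom N k (suc m) n)) (sym x≡0))
... | inj₂ (inj₁ x≡1) =
  trans (cong +_ (after-≡1 N x m n x≡1 1≤x)) (cong (λ r → successors r x (λ k → + cpFrom N k (suc m) n)) (sym x≡1))
... | inj₂ (inj₂ x≡2) = begin
  + after N x (suc m) n
    ≡⟨ trans (cong +_ (after-≡2 N x m n x≡2 1≤x n≤N)) (ℤP.pos-+ E₂ F₄) ⟩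
  + E₂ + + F₄
    ≡⟨ regroup (+ E₂) (+ F₄) (+ F₃) ⟩
  + F₄ + (+ E₂ + + F₃) - + F₃
    ≡⟨ cong (λ t → + F₄ + t - + F₃) (trans (cong +_ (ΣFirst-≥-suc N m n (2 ℕ.+ x) (s≤s z≤n) n≤N)) (ℤP.pos-+ E₂ F₃)) ⟨
  + F₄ + + cpFrom N (2 ℕ.+ x) (suc m) n - + F₃
    ≡⟨ cong (λ r → successors r x (λ k → + cpFrom N k (suc m) n)) x≡2 ⟨
  successors (x % 3) x (λ k → + cpFrom N k (suc m) n) ∎
  where
  E₂ = startingWith N (2 ℕ.+ x) m n
  F₃ = cpFrom N (3 ℕ.+ x) (suc m) n
  F₄ = cpFrom N (4 ℕ.+ x) (suc m) n
  regroup : ∀ e f₄ f₃ → e + f₄ ≡ f₄ + (e + f₃) - f₃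
  regroup = solve-∀

Qℕ : ℕ → ℕ → ℕ
Qℕ n₁ n₂ = 6 ℕ.* n₂ ℕ.* n₂ ℕ.+ 3 ℕ.* n₂ ℕ.+ 2 ℕ.* n₁ ℕ.* n₁ ℕ.+ n₁ ℕ.+ 6 ℕ.* n₂ ℕ.* n₁

+Qℕ : ∀ n₁ n₂ → + Qℕ n₁ n₂ ≡ Q (+ n₁) (+ n₂)
+Qℕ n₁ n₂ =
  trans (+-hom (t₁ ℕ.+ t₂ ℕ.+ t₃ ℕ.+ n₁) t₄) (cong₂ _+_
    (trans (+-hom (t₁ ℕ.+ t₂ ℕ.+ t₃) n₁) (cong (_+ + n₁)
      (trans (+-hom (t₁ ℕ.+ t₂) t₃) (cong₂ _+_
        (trans (+-hom t₁ t₂) (cong₂ _+_ (*-hom₃ 6 n₂ n₂) (ℤP.pos-* 3 n₂)))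
        (*-hom₃ 2 n₁ n₁)))))
    (*-hom₃ 6 n₂ n₁))
  where
  t₁ = 6 ℕ.* n₂ ℕ.* n₂
  t₂ = 3 ℕ.* n₂
  t₃ = 2 ℕ.* n₁ ℕ.* n₁
  t₄ = 6 ℕ.* n₂ ℕ.* n₁
  +-hom = ℤP.pos-+
  *-hom₃ : ∀ a b c → + (a ℕ.* b ℕ.* c) ≡ + a * + b * + c
  *-hom₃ a b c = trans (ℤP.pos-* (a ℕ.* b) c) (cong (_* + c) (ℤP.pos-* a b))

S-vanish : ∀ α β m z → (∀ n₁ n₂ → n₁ ℕ.+ 2 ℕ.* n₂ ≡ m → z ℤ.< + (Qℕ n₁ n₂ ℕ.+ α ℕ.* n₁ ℕ.+ β ℕ.* n₂)) →
           S (+ α) (+ β) m z ≡ + 0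
S-vanish α β m z below =
  Σdiag-zero _ m (λ n₁ n₂ diag → trans (cong (ρ n₁ n₂) (exponent n₁ n₂)) (extend-below _ (below n₁ n₂ diag)))
  where
  collect : ∀ z w u v → z - w - u - v ≡ z - (w + u + v)
  collect = solve-∀
  exponent : ∀ n₁ n₂ → z - Q (+ n₁) (+ n₂) - + α * + n₁ - + β * + n₂ ≡ z - + (Qℕ n₁ n₂ ℕ.+ α ℕ.* n₁ ℕ.+ β ℕ.* n₂)
  exponent n₁ n₂ = trans (collect z _ _ _) (cong (_-_ z) (sym (trans (ℤP.pos-+ (Qℕ n₁ n₂ ℕ.+ α ℕ.* n₁) (β ℕ.* n₂))
                     (cong₂ _+_ (trans (ℤP.pos-+ (Qℕ n₁ n₂) (α ℕ.* n₁)) (cong₂ _+_ (+Qℕ n₁ n₂) (ℤP.pos-* α n₁)))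
                                (ℤP.pos-* β n₂)))))

G-params : ∀ k {r} → 3 ℕ.≤ k → k % 3 ≡ r → ∀ m z → G k m z ≡ S (+ (k ℕ.∸ 3)) (+ 2 * + (k ℕ.∸ 3) + ε r) m z
G-params k 3≤k k≡r m z =
  cong₂ (λ a b → S a b m z) (minus-≥ 3≤k) (cong₂ (λ a r → + 2 * a + ε r) (minus-≥ 3≤k) k≡r)

S-vanish-negative : ∀ α β m {z} → z ℤ.< + 0 → S (+ α) (+ β) m z ≡ + 0
S-vanish-negative α β m {z} z<0 = S-vanish α β m z (λ _ _ _ → ℤP.<-≤-trans z<0 (ℤ.+≤+ z≤n))

G-vanish-negative : ∀ k m {z} → 3 ℕ.≤ k → z ℤ.< + 0 → G k m z ≡ + 0
G-vanish-negative k m {z} 3≤k z<0 with residue k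
... | inj₁ k≡0 = trans (G-params k 3≤k k≡0 m z)
  (trans (cong (λ b → S (+ α) b m z) (trans (ℤP.+-identityʳ _) (sym (ℤP.pos-* 2 α))))
         (S-vanish-negative α (2 ℕ.* α) m z<0))
  where
  α = k ℕ.∸ 3
... | inj₂ (inj₁ k≡1) = trans (G-params k 3≤k k≡1 m z)
  (trans (cong (λ b → S (+ α) (b + + 1) m z) (sym (ℤP.pos-* 2 α)))
         (S-vanish-negative α (2 ℕ.* α ℕ.+ 1) m z<0))
  where
  α = k ℕ.∸ 3
... | inj₂ (inj₂ k≡2) = trans (G-params k 3≤k k≡2 m z)
  (trans (cong (λ b → S (+ α) b m z) (trans (cong (_- + 1) (sym (ℤP.pos-* 2 α))) (minus-≥ 1≤2α)))
         (S-vanish-negative α (2 ℕ.* α ℕ.∸ 1) m z<0))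
  where
  α = k ℕ.∸ 3
  4≤k : 4 ℕ.≤ k
  4≤k = ℕP.≤∧≢⇒< 3≤k (λ 3≡k → contradiction (trans (cong (_% 3) 3≡k) k≡2) λ ())
  1≤2α : 1 ℕ.≤ 2 ℕ.* α
  1≤2α = ℕP.≤-trans (ℕP.∸-monoˡ-≤ 3 4≤k) (ℕP.m≤m+n α _)

-- At k = 3 (j + 1) the exponent (k − 3) n₁ + (2k − 6) n₂ equals 3 j (n₁ + 2 n₂).
G-top : ∀ j m n → n ℕ.< j ℕ.* 3 → G (suc j ℕ.* 3) (suc m) (+ n) ≡ + 0
G-top j m n n<α =
  trans (G-params (suc j ℕ.* 3) (s≤s (s≤s (s≤s z≤n))) (m*n%n≡0 (suc j) 3) (suc m) (+ n))
        (trans (cong (λ b → S (+ α) b (suc m) (+ n)) (trans (ℤP.+-identityʳ _) (sym (ℤP.pos-* 2 α))))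
               (S-vanish α (2 ℕ.* α) (suc m) (+ n) (λ n₁ n₂ diag → ℤ.+<+ (bound n₁ n₂ diag))))
  where
  α = j ℕ.* 3
  bound : ∀ n₁ n₂ → n₁ ℕ.+ 2 ℕ.* n₂ ≡ suc m → n ℕ.< Qℕ n₁ n₂ ℕ.+ α ℕ.* n₁ ℕ.+ 2 ℕ.* α ℕ.* n₂
  bound n₁ n₂ diag =
    ℕP.<-≤-trans n<α (ℕP.≤-trans (ℕP.m≤m*n α (n₁ ℕ.+ 2 ℕ.* n₂) {{subst ℕ.NonZero (sym diag) _}})
      (ℕP.≤-trans (ℕP.≤-reflexive (distribute α n₁ n₂))
        (ℕP.≤-trans (ℕP.m≤n+m _ (Qℕ n₁ n₂)) (ℕP.≤-reflexive (sym (ℕP.+-assoc (Qℕ n₁ n₂) _ _))))))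
    where
    distribute : ∀ a x y → a ℕ.* (x ℕ.+ 2 ℕ.* y) ≡ a ℕ.* x ℕ.+ 2 ℕ.* a ℕ.* y
    distribute = ℕ-Solver.solve-∀

G-zero : ∀ k n → G k 0 (+ n) ≡ 𝟙 n
G-zero k n = trans (cong (ρ 0 0) (drop (+ n) (aG k) (bG k))) (ρ-0-0 n)
  where
  drop : ∀ z a b → z - + 0 - a * + 0 - b * + 0 ≡ z
  drop = solve-∀

minus-<0 : ∀ {n x} → n ℕ.< x → + n - + x ℤ.< + 0
minus-<0 {n} {x} n<x rewrite ℤP.m-n≡m⊖n n x | ℤP.⊖-< n<x =
  ℤP.neg-mono-< {+ 0} {+ (x ℕ.∸ n)} (ℤ.+<+ (ℕP.m<n⇒0<n∸m n<x))

Gnext-vanish-negative : ∀ x m {z} → 1 ℕ.≤ x → z ℤ.< + 0 → Gnext x m z ≡ + 0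
Gnext-vanish-negative x m 1≤x z<0 =
  trans (successors-cong (x % 3) x (λ k 2+x≤k → G-vanish-negative k m (ℕP.≤-trans (ℕP.+-monoʳ-≤ 2 1≤x) 2+x≤k) z<0))
        (successors-const (x % 3) x (+ 0))

startingWith-G : ∀ N m → (∀ k n → 1 ℕ.≤ k → n ℕ.≤ N → + cpFrom N k m n ≡ G k m (+ n)) →
                 ∀ x n → 1 ℕ.≤ x → n ℕ.≤ N → + startingWith N x m n ≡ Gnext x m (+ n - + x)
startingWith-G N m cpFrom≡G x n 1≤x n≤N with x ℕ.≤? n
... | yes x≤n = begin
  + startingWith N x m n
    ≡⟨ cong +_ (if-yes (x ℕ.≤? n) x≤n) ⟩
  + after N x m (n ℕ.∸ x)
    ≡⟨ after-successors N x m (n ℕ.∸ x) 1≤x n∸x≤N ⟩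
  successors (x % 3) x (λ k → + cpFrom N k m (n ℕ.∸ x))
    ≡⟨ successors-cong (x % 3) x (λ k 2+x≤k → cpFrom≡G k (n ℕ.∸ x) (ℕP.≤-trans (s≤s z≤n) 2+x≤k) n∸x≤N) ⟩
  Gnext x m (+ (n ℕ.∸ x))
    ≡⟨ cong (Gnext x m) (minus-≥ x≤n) ⟨
  Gnext x m (+ n - + x) ∎
  where
  n∸x≤N = ℕP.≤-trans (ℕP.m∸n≤m n x) n≤N
... | no x≰n = trans (cong +_ (if-no (x ℕ.≤? n) x≰n)) (sym (Gnext-vanish-negative x m 1≤x (minus-<0 (ℕP.≰⇒> x≰n))))

-- For fixed m, descending induction on k from a multiple of 3 beyond n, where both sides vanish.
cpFrom-G : ∀ N m k n → 1 ℕ.≤ k → n ℕ.≤ N → + cpFrom N k m n ≡ G k m (+ n)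
cpFrom-G N zero    k n _   _   = trans (if-float +_ (does (n ℕ.≟ 0))) (sym (G-zero k n))
cpFrom-G N (suc m) k n 1≤k n≤N = descend (suc j ℕ.* 3 ℕ.∸ k) k 1≤k (ℕP.m∸n+n≡m k≤top)
  where
  j = k ℕ.+ n
  n<j*3 : n ℕ.< j ℕ.* 3
  n<j*3 = ℕP.<-≤-trans (ℕP.m<n+m n 1≤k) (ℕP.m≤m*n j 3)
  k≤top : k ℕ.≤ suc j ℕ.* 3
  k≤top = ℕP.≤-trans (ℕP.m≤m+n k n) (ℕP.≤-trans (ℕP.m≤m*n j 3) (ℕP.m≤n+m (j ℕ.* 3) 3))
  descend : ∀ d k → 1 ℕ.≤ k → d ℕ.+ k ≡ suc j ℕ.* 3 → + cpFrom N k (suc m) n ≡ G k (suc m) (+ n)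
  descend zero    k _ refl =
    trans (cong +_ (ΣFirst-≥-empty N m n (suc j ℕ.* 3) (ℕP.<-≤-trans n<j*3 (ℕP.m≤n+m (j ℕ.* 3) 3))))
          (sym (G-top j m n n<j*3))
  descend (suc d) k 1≤k d+k≡top = begin
    + cpFrom N k (suc m) n
      ≡⟨ cong +_ (ΣFirst-≥-suc N m n k 1≤k n≤N) ⟩
    + (startingWith N k m n ℕ.+ cpFrom N (suc k) (suc m) n)
      ≡⟨ ℤP.pos-+ (startingWith N k m n) (cpFrom N (suc k) (suc m) n) ⟩
    + startingWith N k m n + + cpFrom N (suc k) (suc m) n
      ≡⟨ cong₂ _+_ (startingWith-G N m (cpFrom-G N m) k n 1≤k n≤N)
                   (descend d (suc k) (s≤s z≤n) (trans (ℕP.+-suc d k) d+k≡top)) ⟩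
    Gnext k m (+ n - + k) + G (suc k) (suc m) (+ n)
      ≡⟨ ℤP.+-comm (Gnext k m (+ n - + k)) _ ⟩
    G (suc k) (suc m) (+ n) + Gnext k m (+ n - + k)
      ≡⟨ x-y≡t⇒y+t≡x (G-diff k (suc m) (+ n)) ⟩
    G k (suc m) (+ n) ∎

cp₂-G : ∀ n m → + cp₂ n m ≡ G 3 m (+ n) + xq 1 (+ 1) (G 5) m (+ n)
cp₂-G n zero    = trans (cong +_ (cp₂-zero n)) (trans (cpFrom-G n 0 3 n (s≤s z≤n) ℕP.≤-refl) (sym (ℤP.+-identityʳ _)))
cp₂-G n (suc m) = begin
  + cp₂ n (suc m)
    ≡⟨ cong +_ (begin
         cp₂ n (suc m)
           ≡⟨ cp₂-suc n m ⟩
         ΣFirst n m n (λ y → ¬? (y ℕ.≟ 2))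
           ≡⟨ ΣFirst-cong n m n (λ y → ¬? (y ℕ.≟ 2)) (λ y → (y ℕ.≟ 1) ⊎-dec (3 ℕ.≤? y)) (λ y 1≤y → mk⇔ (to 1≤y) from) ⟩
         ΣFirst n m n (λ y → (y ℕ.≟ 1) ⊎-dec (3 ℕ.≤? y))
           ≡⟨ ΣFirst-⊎ n m n (ℕ._≟ 1) (3 ℕ.≤?_) (λ { _ refl (s≤s ()) }) ⟩
         ΣFirst n m n (ℕ._≟ 1) ℕ.+ cpFrom n 3 (suc m) n
           ≡⟨ cong (ℕ._+ cpFrom n 3 (suc m) n) (ΣFirst-≡ n m n 1 ℕP.≤-refl ℕP.≤-refl) ⟩
         startingWith n 1 m n ℕ.+ cpFrom n 3 (suc m) n ∎) ⟩
  + (startingWith n 1 m n ℕ.+ cpFrom n 3 (suc m) n)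
    ≡⟨ ℤP.pos-+ (startingWith n 1 m n) (cpFrom n 3 (suc m) n) ⟩
  + startingWith n 1 m n + + cpFrom n 3 (suc m) n
    ≡⟨ cong₂ _+_ (startingWith-G n m (cpFrom-G n m) 1 n ℕP.≤-refl ℕP.≤-refl)
                 (cpFrom-G n (suc m) 3 n (s≤s z≤n) ℕP.≤-refl) ⟩
  G 5 m (+ n - + 1) + G 3 (suc m) (+ n)
    ≡⟨ ℤP.+-comm (G 5 m (+ n - + 1)) _ ⟩
  G 3 (suc m) (+ n) + G 5 m (+ n - + 1) ∎
  where
  to : ∀ {y} → 1 ℕ.≤ y → y ≢ 2 → y ≡ 1 ⊎ 3 ℕ.≤ y
  to {suc zero}          _ _   = inj₁ refl
  to {suc (suc zero)}    _ y≢2 = contradiction refl y≢2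
  to {suc (suc (suc _))} _ _   = inj₂ (s≤s (s≤s (s≤s z≤n)))
  from : ∀ {y} → y ≡ 1 ⊎ 3 ℕ.≤ y → y ≢ 2
  from (inj₁ refl) ()
  from (inj₂ (s≤s (s≤s ()))) refl

xPow-⊛ : ∀ k f h m n → (xPow k f m ⊛ h) n ≡ (if does (m ℕ.≟ k) then (f ⊛ h) n else + 0)
xPow-⊛ k f h m n = by-cases (m ℕ.≟ k)
  where
  by-cases : (d : Dec (m ≡ k)) → ((if does d then f else 𝟘) ⊛ h) n ≡ (if does d then (f ⊛ h) n else + 0)
  by-cases (yes _) = refl
  by-cases (no _)  = Σ≤-zero n (λ i _ → ℤP.*-zeroˡ (h (n ℕ.∸ i)))

term-value : ∀ n₁ n₂ m n → term n₁ n₂ m n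
  ≡ (if does (m ℕ.≟ 2 ℕ.* n₂ ℕ.+ n₁) then ρ n₁ n₂ (+ n - + Qℕ n₁ n₂) else + 0)
  + (if does (m ℕ.≟ suc (2 ℕ.* n₂ ℕ.+ n₁)) then ρ n₁ n₂ (+ n - + (Qℕ n₁ n₂ ℕ.+ (3 ℕ.* n₂ ℕ.+ 2 ℕ.* n₁ ℕ.+ 1))) else + 0)
term-value n₁ n₂ m n =
  trans (⊛-distribʳ-⊕ (xPow d (mono (+ 1) e) m) (xPow (suc d) (mono (+ 1) e′) m) (inv (denom n₁ n₂)) n)
        (cong₂ _+_ (trans (xPow-⊛ d (mono (+ 1) e) (inv (denom n₁ n₂)) m n)
                          (cong (λ v → if does (m ℕ.≟ d) then v else + 0) (monomial-⊛-inv e)))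
                   (trans (xPow-⊛ (suc d) (mono (+ 1) e′) (inv (denom n₁ n₂)) m n)
                          (cong (λ v → if does (m ℕ.≟ suc d) then v else + 0) (monomial-⊛-inv e′))))
  where
  d  = 2 ℕ.* n₂ ℕ.+ n₁
  e  = Qℕ n₁ n₂
  e′ = Qℕ n₁ n₂ ℕ.+ (3 ℕ.* n₂ ℕ.+ 2 ℕ.* n₁ ℕ.+ 1)
  monomial-⊛-inv : ∀ e → (mono (+ 1) e ⊛ inv (denom n₁ n₂)) n ≡ ρ n₁ n₂ (+ n - + e)
  monomial-⊛-inv e = trans (⊛-comm (mono (+ 1) e) (inv (denom n₁ n₂)) n) (⊛-monomial (inv (denom n₁ n₂)) e n)

column : (ℕ → ℕ → ℤ) → ℕ → ℕ → ℕ → ℤ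
column f m M₁ n₂ = Σ≤ M₁ (λ n₁ → if does (m ℕ.≟ 2 ℕ.* n₂ ℕ.+ n₁) then f n₁ n₂ else + 0)

column-zero : ∀ f m M₁ → m ℕ.≤ M₁ → column f m M₁ 0 ≡ f m 0
column-zero f m M₁ m≤M₁ =
  trans (Σ≤-single M₁ m m≤M₁ (λ i _ i≢m → if-no (m ℕ.≟ i) (λ m≡i → i≢m (sym m≡i)))) (if-yes (m ℕ.≟ m) refl)

column-small : ∀ f m M₁ → m ℕ.< 2 → ∀ n₂ → column f m M₁ (suc n₂) ≡ + 0
column-small f m M₁ m<2 n₂ = Σ≤-zero M₁ (λ n₁ _ → if-no (m ℕ.≟ 2 ℕ.* suc n₂ ℕ.+ n₁)
  (λ m≡ → ℕP.<⇒≱ m<2 (subst (2 ℕ.≤_) (sym m≡) (ℕP.≤-trans (ℕP.*-monoʳ-≤ 2 (s≤s z≤n)) (ℕP.m≤m+n _ n₁)))))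

column-suc : ∀ f m M₁ n₂ → column f (2 ℕ.+ m) M₁ (suc n₂) ≡ column (λ n₁ n₂ → f n₁ (suc n₂)) m M₁ n₂
column-suc f m M₁ n₂ =
  Σ≤-cong M₁ (λ n₁ _ → cong (λ t → if does (2 ℕ.+ m ℕ.≟ t) then f n₁ (suc n₂) else + 0) (cong (ℕ._+ n₁) (ℕP.*-suc 2 n₂)))

Σ≤-column : ∀ f m M₁ M₂ → m ℕ.≤ M₁ → m ℕ.≤ M₂ → Σ≤ M₂ (column f m M₁) ≡ Σdiag f m
Σ≤-column f zero          M₁ zero     m≤M₁ _ = column-zero f 0 M₁ m≤M₁
Σ≤-column f zero          M₁ (suc M₂) m≤M₁ _ =
  trans (Σ≤-unfoldˡ M₂ (column f 0 M₁))
        (trans (cong₂ _+_ (column-zero f 0 M₁ m≤M₁) (Σ≤-zero M₂ (λ n₂ _ → column-small f 0 M₁ (s≤s z≤n) n₂)))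
               (ℤP.+-identityʳ (f 0 0)))
Σ≤-column f (suc zero)    M₁ (suc M₂) m≤M₁ _ =
  trans (Σ≤-unfoldˡ M₂ (column f 1 M₁))
        (trans (cong₂ _+_ (column-zero f 1 M₁ m≤M₁) (Σ≤-zero M₂ (λ n₂ _ → column-small f 1 M₁ ℕP.≤-refl n₂)))
               (ℤP.+-identityʳ (f 1 0)))
Σ≤-column f (suc (suc m)) M₁ (suc M₂) m≤M₁ (s≤s 1+m≤M₂) =
  trans (Σ≤-unfoldˡ M₂ (column f (2 ℕ.+ m) M₁))
        (cong₂ _+_ (column-zero f (2 ℕ.+ m) M₁ m≤M₁)
                   (trans (Σ≤-cong M₂ (λ n₂ _ → column-suc f m M₁ n₂))
                          (Σ≤-column _ m M₁ M₂ (ℕP.≤-trans (ℕP.m≤n+m m 2) m≤M₁) (ℕP.<⇒≤ 1+m≤M₂))))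

sum-side₀ : ∀ m n → Σ≤ m (λ n₁ → Σ≤ m (λ n₂ → if does (m ℕ.≟ 2 ℕ.* n₂ ℕ.+ n₁) then ρ n₁ n₂ (+ n - + Qℕ n₁ n₂) else + 0))
                    ≡ S (+ 0) (+ 0) m (+ n)
sum-side₀ m n = trans (Σ≤-comm m m _) (trans (Σ≤-column _ m m m ℕP.≤-refl ℕP.≤-refl) (Σdiag-cong exponent m))
  where
  pad : ∀ z w x y → z - w ≡ z - w - + 0 * x - + 0 * y
  pad = solve-∀
  exponent : ∀ n₁ n₂ → ρ n₁ n₂ (+ n - + Qℕ n₁ n₂) ≡ T (+ 0) (+ 0) n₁ n₂ (+ n)
  exponent n₁ n₂ = cong (ρ n₁ n₂) (trans (cong (_-_ (+ n)) (+Qℕ n₁ n₂)) (pad (+ n) (Q (+ n₁) (+ n₂)) (+ n₁) (+ n₂)))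

sum-side₁ : ∀ m n → Σ≤ m (λ n₁ → Σ≤ m (λ n₂ → if does (m ℕ.≟ suc (2 ℕ.* n₂ ℕ.+ n₁))
                                                then ρ n₁ n₂ (+ n - + (Qℕ n₁ n₂ ℕ.+ (3 ℕ.* n₂ ℕ.+ 2 ℕ.* n₁ ℕ.+ 1)))
                                                else + 0))
                    ≡ xq 1 (+ 1) (S (+ 2) (+ 3)) m (+ n)
sum-side₁ zero    n = refl
sum-side₁ (suc m) n =
  trans (Σ≤-comm (suc m) (suc m) _) (trans (Σ≤-column _ m (suc m) (suc m) (ℕP.n≤1+n m) (ℕP.n≤1+n m)) (Σdiag-cong exponent m))
  where
  regroup : ∀ z w x y → z - (w + (+ 3 * y + + 2 * x + + 1)) ≡ z - + 1 - w - + 2 * x - + 3 * y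
  regroup = solve-∀
  exponent : ∀ n₁ n₂ → ρ n₁ n₂ (+ n - + (Qℕ n₁ n₂ ℕ.+ (3 ℕ.* n₂ ℕ.+ 2 ℕ.* n₁ ℕ.+ 1))) ≡ T (+ 2) (+ 3) n₁ n₂ (+ n - + 1)
  exponent n₁ n₂ = cong (ρ n₁ n₂) (trans (cong (_-_ (+ n)) cast) (regroup (+ n) (Q (+ n₁) (+ n₂)) (+ n₁) (+ n₂)))
    where
    cast : + (Qℕ n₁ n₂ ℕ.+ (3 ℕ.* n₂ ℕ.+ 2 ℕ.* n₁ ℕ.+ 1)) ≡ Q (+ n₁) (+ n₂) + (+ 3 * + n₂ + + 2 * + n₁ + + 1)
    cast = trans (ℤP.pos-+ (Qℕ n₁ n₂) _) (cong₂ _+_ (+Qℕ n₁ n₂)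
             (trans (ℤP.pos-+ (3 ℕ.* n₂ ℕ.+ 2 ℕ.* n₁) 1) (cong (_+ + 1)
               (trans (ℤP.pos-+ (3 ℕ.* n₂) (2 ℕ.* n₁)) (cong₂ _+_ (ℤP.pos-* 3 n₂) (ℤP.pos-* 2 n₁))))))

rhs-S : ∀ m n → rhsCoeff m n ≡ S (+ 0) (+ 0) m (+ n) + xq 1 (+ 1) (S (+ 2) (+ 3)) m (+ n)
rhs-S m n = begin
  Σ≤ m (λ n₁ → Σ≤ m (λ n₂ → term n₁ n₂ m n))
    ≡⟨ Σ≤-cong m (λ n₁ _ → trans (Σ≤-cong m (λ n₂ _ → term-value n₁ n₂ m n)) (Σ≤-distrib-+ m (A n₁) (B n₁))) ⟩
  Σ≤ m (λ n₁ → Σ≤ m (A n₁) + Σ≤ m (B n₁))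
    ≡⟨ Σ≤-distrib-+ m (λ n₁ → Σ≤ m (A n₁)) (λ n₁ → Σ≤ m (B n₁)) ⟩
  Σ≤ m (λ n₁ → Σ≤ m (A n₁)) + Σ≤ m (λ n₁ → Σ≤ m (B n₁))
    ≡⟨ cong₂ _+_ (sum-side₀ m n) (sum-side₁ m n) ⟩
  S (+ 0) (+ 0) m (+ n) + xq 1 (+ 1) (S (+ 2) (+ 3)) m (+ n) ∎
  where
  A B : ℕ → ℕ → ℤ
  A n₁ n₂ = if does (m ℕ.≟ 2 ℕ.* n₂ ℕ.+ n₁) then ρ n₁ n₂ (+ n - + Qℕ n₁ n₂) else + 0
  B n₁ n₂ = if does (m ℕ.≟ suc (2 ℕ.* n₂ ℕ.+ n₁)) then ρ n₁ n₂ (+ n - + (Qℕ n₁ n₂ ℕ.+ (3 ℕ.* n₂ ℕ.+ 2 ℕ.* n₁ ℕ.+ 1))) else + 0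

theorem9 : ∀ (m n : ℕ) → + cp₂ n m ≡ rhsCoeff m n
theorem9 m n = trans (cp₂-G n m) (sym (rhs-S m n))
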